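{- For integers $k\ge 2$, $m\ge k$ and $b$ with $k-2\le b$ (and additionally $b\le \frac{km-4k+4}{k-2}$ when $k\ge 3$) such that $k(m-b)$ is even, define $$f(k,m,b)(q)=\binom{m}{k}_q-q^{\frac{k(m-b)}{2}+b-2k+2}\binom{b}{k-2}_q .$$ Then: (i) If $k=2$, then $f(2,m,b)$ is nonnegative and unimodal if and only if $m$ is even. (ii) If $k=3$ (so $m\ge 3$, $1\le b\le 3m-8$, $b\equiv m \pmod 2$), then $f(3,m,b)$ is nonnegative and unimodal if and only if $b\ne 3m-10$ and moreover: $b\ne 2$ if $m$ is even; $b\ne 1$ and $b\neq 5$ if $m\equiv 1\pmod 4$; and $b\ne 3$ if $m\equiv 3\pmod 4$. (iii) If $k=4$ (so $m\ge 4$, $2\le b\le 2m-6$), then $f(4,m,b)$ is nonnegative and unimodal if and only if $b$ is even and $m\ne 5$.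
   Context: For integers $m\ge k\ge 0$ the $q$-binomial coefficient is $\binom{m}{k}_q=\prod_{i=1}^{m}(1-q^i)\big/\big(\prod_{i=1}^{k}(1-q^i)\prod_{i=1}^{m-k}(1-q^i)\big)$, a polynomial in $q$ of degree $k(m-k)$. A polynomial is nonnegative if all its coefficients are $\ge 0$, and unimodal if its coefficient sequence weakly increases up to some index and weakly decreases afterwards. Note $f(k,m,b)$ is symmetric about degree $k(m-k)/2$. -}

module Defs where

open import Data.Bool using (if_then_else_)
open import Data.Nat as ℕ using (ℕ; zero; suc; _∸_; _≤ᵇ_)
open import Data.Nat.Divisibility using (_∣_)
open import Data.Integer as ℤ using (ℤ; +_; _-_)
open import Data.Product using (_×_; ∃-syntax)

-- Formal power series / polynomials over ℤ, given by their coefficient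
-- function: s n = coefficient of q^n.
Series : Set
Series = ℕ → ℤ

one : Series
one zero    = + 1
one (suc _) = + 0

-- multiplication by q^e
shiftBy : ℕ → Series → Series
shiftBy e a n = if e ≤ᵇ n then a (n ∸ e) else + 0

mulOneMinus : ℕ → Series → Series
mulOneMinus i a n = a n - shiftBy i a n

sumTo : ℕ → (ℕ → ℤ) → ℤ
sumTo zero    f = f 0
sumTo (suc t) f = sumTo t f ℤ.+ f (suc t)

-- division by (1 - q^(suc j)) as a formal power series:
-- (a / (1 - q^i)) n = Σ_{t=0}^{⌊n/i⌋} a (n - t i),  i = suc j ≥ 1
divOneMinusSuc : ℕ → Series → Series
divOneMinusSuc j a n = sumTo (n ℕ./ suc j) (λ t → a (n ∸ t ℕ.* suc j))

mulProd : ℕ → Series → Series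
mulProd zero    a = a
mulProd (suc m) a = mulOneMinus (suc m) (mulProd m a)

divProd : ℕ → Series → Series
divProd zero    a = a
divProd (suc k) a = divOneMinusSuc k (divProd k a)

-- q-binomial coefficient  [m choose k]_q
--   = ∏_{i=1}^m (1-q^i) / (∏_{i=1}^k (1-q^i) ∏_{i=1}^{m-k} (1-q^i))
-- (intended for k ≤ m; the quotient of power series is then the polynomial)
qbinom : ℕ → ℕ → Series
qbinom m k = divProd (m ∸ k) (divProd k (mulProd m one))

-- exponent  k(m-b)/2 + b - 2k + 2 = (k m - (k-2) b)/2 - (2k - 2);
-- under the hypotheses of the theorem all subtractions are exact.
expo : ℕ → ℕ → ℕ → ℕ
expo k m b = ((k ℕ.* m ∸ (k ∸ 2) ℕ.* b) ℕ./ 2) ∸ (2 ℕ.* k ∸ 2)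

f : ℕ → ℕ → ℕ → Series
f k m b n = qbinom m k n - shiftBy (expo k m b) (qbinom b (k ∸ 2)) n

Nonnegative : Series → Set
Nonnegative a = ∀ n → + 0 ℤ.≤ a n

Unimodal : Series → Set
Unimodal a = ∃[ j ] ((∀ i → i ℕ.< j → a i ℤ.≤ a (suc i))
                   × (∀ i → j ℕ.≤ i → a (suc i) ℤ.≤ a i))

-- standing hypotheses: k ≥ 2, m ≥ k, k-2 ≤ b,
-- (k ≥ 3 → b ≤ (km-4k+4)/(k-2), i.e. (k-2) b ≤ km - 4k + 4), k(m-b) even
-- (k(m-b) ≡ k(m+b) mod 2, so this is stated as 2 ∣ k m + k b).
Admissible : ℕ → ℕ → ℕ → Set
Admissible k m b =
  (2 ℕ.≤ k) × (k ℕ.≤ m) × (k ∸ 2 ℕ.≤ b)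
  × (3 ℕ.≤ k → (k ∸ 2) ℕ.* b ℕ.≤ k ℕ.* m ℕ.+ 4 ∸ 4 ℕ.* k)
  × (2 ∣ k ℕ.* m ℕ.+ k ℕ.* b)

module Submission where

-- Write m = k + s and b = (k - 2) + s'.  Both q-binomials are palindromic
-- (gauss-palindromic, via the q-Pascal recurrences), and the exponent is
-- chosen so that f is palindromic of degree k·s.  A palindromic series is
-- nonnegative and unimodal as soon as its constant term is nonnegative and it
-- increases up to the middle (palindromic-unimodal), and fails to be unimodal
-- if it strictly decreases somewhere before the middle
-- (palindromic-not-unimodal).  So everything hinges on the first difference
-- (1 - q) f on the lower half, which difference-gauss-low expresses through
-- partition counts with small parts (p_2, p_{12}, p_{23}, p_{123}, p_{234}).

open import Defs

module Development where
  open import Data.Bool as Bool using (Bool; true; false; if_then_else_)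
  open import Data.Unit using (tt)
  open import Data.Empty
  open import Data.Nat as N using (ℕ; zero; suc; _∸_; z≤n; s≤s; _%_)
  import Data.Nat.Properties as NP
  open import Data.Nat.DivMod using (m<n⇒m/n≡0; m/n≡1+[m∸n]/n; m*n/n≡m; [m+kn]%n≡m%n; m≡m%n+[m/n]*n)
  open import Data.Nat.Divisibility using (_∣_; divides)
  import Data.Nat.Tactic.RingSolver as NS
  open import Data.Integer as Z using (ℤ; +_; _-_; _+_; -_)
  import Data.Integer.Properties as ZP
  open import Data.Integer.Tactic.RingSolver
  open import Data.Product using (_×_; _,_; proj₁; proj₂; Σ)
  open import Data.Sum using (_⊎_; inj₁; inj₂; [_,_]′)
  open import Function.Base using (_∘_)
  open import Function.Bundles using (_⇔_; mk⇔)
  open import Relation.Binary.PropositionalEquality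
  open import Relation.Nullary using (yes; no; ¬_)

  ≗-trans : {a b c : Series} → a ≗ b → b ≗ c → a ≗ c
  ≗-trans p q n = trans (p n) (q n)

  ≗-sym : {a b : Series} → a ≗ b → b ≗ a
  ≗-sym p n = sym (p n)

  ∸-of-+ : ∀ {a} b {c} → a ≡ b N.+ c → a ∸ b ≡ c
  ∸-of-+ b {c} eq = trans (cong (_∸ b) eq) (NP.m+n∸m≡n b c)

  parity : ∀ n → Σ ℕ (λ t → (n ≡ t N.+ t) ⊎ (n ≡ suc (t N.+ t)))
  parity zero = 0 , inj₁ refl
  parity (suc n) with parity n
  ... | t , inj₁ p = t , inj₂ (cong suc p)
  ... | t , inj₂ p = suc t , inj₁ (trans (cong suc p) (cong suc (sym (NP.+-suc t t))))

  odd≢even : ∀ u q → suc (u N.+ u) ≢ q N.+ q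
  odd≢even zero zero ()
  odd≢even zero (suc q) p = NP.0≢1+n (NP.suc-injective (trans p (NP.+-suc (suc q) q)))
  odd≢even (suc u) zero ()
  odd≢even (suc u) (suc q) p = odd≢even u q (NP.suc-injective (trans (sym (NP.+-suc (suc u) u)) (trans (NP.suc-injective p) (NP.+-suc q q))))

  double-injective : ∀ x y → x N.+ x ≡ y N.+ y → x ≡ y
  double-injective zero zero p = refl
  double-injective zero (suc y) ()
  double-injective (suc x) zero ()
  double-injective (suc x) (suc y) p = cong suc (double-injective x y (NP.suc-injective (trans (sym (NP.+-suc x x)) (trans (NP.suc-injective p) (NP.+-suc y y)))))

  2∣double : ∀ u → 2 ∣ (u N.+ u)
  2∣double u = divides u (l u)
    where
    l : ∀ u → u N.+ u ≡ u N.* 2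
    l = NS.solve-∀

  2∤odd : ∀ u → ¬ (2 ∣ suc (u N.+ u))
  2∤odd u (divides q eq) = odd≢even u q (trans eq (l q))
    where
    l : ∀ q → q N.* 2 ≡ q N.+ q
    l = NS.solve-∀

  2∣2+double : ∀ {n} u → n ≡ u N.+ u → 2 ∣ 2 N.+ n
  2∣2+double u refl = subst (2 ∣_) (cong suc (NP.+-suc u u)) (2∣double (suc u))

  2∤2+odd : ∀ {n} u → n ≡ suc (u N.+ u) → ¬ (2 ∣ 2 N.+ n)
  2∤2+odd u refl = 2∤odd (suc u) ∘ subst (2 ∣_) (cong suc (sym (NP.+-suc (suc u) u)))

  double/2 : ∀ x → (x N.+ x) N./ 2 ≡ x
  double/2 x = trans (cong (N._/ 2) (l x)) (m*n/n≡m x 2)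
    where
    l : ∀ x → x N.+ x ≡ x N.* 2
    l = NS.solve-∀

  double-cancel-≤ : ∀ x y → x N.+ x N.≤ y N.+ y → x N.≤ y
  double-cancel-≤ x y p with x N.≤? y
  ... | yes q = q
  ... | no q = ⊥-elim (NP.<⇒≱ (NP.+-mono-< (NP.≰⇒> q) (NP.≰⇒> q)) p)

  double-cancel-< : ∀ t s → suc (t N.+ t) N.≤ s N.+ s → suc t N.≤ s
  double-cancel-< t s p with suc t N.≤? s
  ... | yes q = q
  ... | no q = ⊥-elim (NP.<⇒≱ p (NP.+-mono-≤ s≤t s≤t))
    where
    s≤t : s N.≤ t
    s≤t = NP.≤-pred (NP.≰⇒> q)

  mod4≡1 : ∀ s → (3 N.+ s) % 4 ≡ 1 → Σ ℕ (λ w → s ≡ 4 N.* w N.+ 2)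
  mod4≡1 s p with (3 N.+ s) N./ 4 | trans (m≡m%n+[m/n]*n (3 N.+ s) 4) (cong (N._+ ((3 N.+ s) N./ 4) N.* 4) p)
  ... | zero | ()
  ... | suc w | q = w , NP.+-cancelˡ-≡ 3 s (4 N.* w N.+ 2) (trans q (l w))
    where
    l : ∀ w → 1 N.+ suc w N.* 4 ≡ 3 N.+ (4 N.* w N.+ 2)
    l = NS.solve-∀

  mod4≡3 : ∀ s → (3 N.+ s) % 4 ≡ 3 → Σ ℕ (λ w → s ≡ 4 N.* w)
  mod4≡3 s p = ((3 N.+ s) N./ 4) , NP.+-cancelˡ-≡ 3 s _ (trans (trans (m≡m%n+[m/n]*n (3 N.+ s) 4) (cong (N._+ ((3 N.+ s) N./ 4) N.* 4) p)) (cong (3 N.+_) (NP.*-comm ((3 N.+ s) N./ 4) 4)))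

  mod4≡1-intro : ∀ w → (3 N.+ (4 N.* w N.+ 2)) % 4 ≡ 1
  mod4≡1-intro w = trans (cong (_% 4) (l w)) ([m+kn]%n≡m%n 1 (suc w) 4)
    where
    l : ∀ w → 3 N.+ (4 N.* w N.+ 2) ≡ 1 N.+ suc w N.* 4
    l = NS.solve-∀

  mod4≡3-intro : ∀ w → (3 N.+ (4 N.* w N.+ 4)) % 4 ≡ 3
  mod4≡3-intro w = trans (cong (_% 4) (l w)) ([m+kn]%n≡m%n 3 (suc w) 4)
    where
    l : ∀ w → 3 N.+ (4 N.* w N.+ 4) ≡ 3 N.+ suc w N.* 4
    l = NS.solve-∀

  sub-nonneg⇒≤ : ∀ {a b : ℤ} → + 0 Z.≤ a - b → b Z.≤ a
  sub-nonneg⇒≤ {a} {b} p = subst₂ Z._≤_ (ZP.+-identityʳ b) (lem a b) (ZP.+-monoʳ-≤ b p)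
    where
    lem : ∀ a b → b + (a - b) ≡ a
    lem = solve-∀

  sub-nonneg : ∀ {a b : ℤ} → b Z.≤ a → + 0 Z.≤ a - b
  sub-nonneg {a} {b} p = subst (Z._≤ a - b) (ZP.+-inverseʳ b) (ZP.+-monoˡ-≤ (- b) p)

  sub-neg⇒< : ∀ {a b : ℤ} → a - b Z.< + 0 → a Z.< b
  sub-neg⇒< {a} {b} p = subst₂ Z._<_ (lem a b) (ZP.+-identityʳ b) (ZP.+-monoʳ-< b p)
    where
    lem : ∀ a b → b + (a - b) ≡ a
    lem = solve-∀

  one≤sub : ∀ {a b c : ℤ} → c Z.≤ a → a + + 1 Z.≤ b → + 1 Z.≤ b - c
  one≤sub {a} {b} {c} p q = subst (+ 1 Z.≤_) (lem b c) (ZP.+-monoˡ-≤ (+ 1) (sub-nonneg (ZP.≤-trans (ZP.+-monoˡ-≤ (+ 1) p) q)))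
    where
    lem : ∀ (b c : ℤ) → b - (c + + 1) + + 1 ≡ b - c
    lem = solve-∀

  one≤sub-ℕ : ∀ {b c} → suc b N.≤ c → + 1 Z.≤ + c - + b
  one≤sub-ℕ {b} {c} p = one≤sub {+ b} {+ c} {+ b} ZP.≤-refl (Z.+≤+ (subst (N._≤ c) (NP.+-comm 1 b) p))

  sub-nonneg-of-bounds : ∀ {a c : ℤ} → + 1 Z.≤ a → c Z.≤ + 1 → + 0 Z.≤ a - c
  sub-nonneg-of-bounds p q = sub-nonneg (ZP.≤-trans q p)

  -- -1 is negative; the witness against nonnegativity for m = 5, b = 4.
  -1-negative : ¬ (+ 0 Z.≤ Z.-[1+ 0 ])
  -1-negative ()

  suc-sub-suc : ∀ (x y : ℤ) → (+ 1 + x) - (+ 1 + y) ≡ x - y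
  suc-sub-suc = solve-∀

  suc-sub : ∀ (x : ℤ) → (+ 1 + x) - x ≡ + 1
  suc-sub = solve-∀

  increasing-by : ∀ (g : Series) C → (∀ n → suc n N.≤ C → g n Z.≤ g (suc n)) → ∀ d a → a N.+ d N.≤ C → g a Z.≤ g (a N.+ d)
  increasing-by g C inc zero a p = ZP.≤-reflexive (cong g (sym (NP.+-identityʳ a)))
  increasing-by g C inc (suc d) a p = ZP.≤-trans (increasing-by g C inc d a (NP.≤-trans (NP.+-monoʳ-≤ a (NP.n≤1+n d)) p))
     (subst (λ z → g (a N.+ d) Z.≤ g z) (sym (NP.+-suc a d)) (inc (a N.+ d) (subst (N._≤ C) (NP.+-suc a d) p)))

  increasing-between : ∀ (g : Series) C → (∀ n → suc n N.≤ C → g n Z.≤ g (suc n)) → ∀ a b → a N.≤ b → b N.≤ C → g a Z.≤ g b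
  increasing-between g C inc a b a≤b b≤C = subst (λ z → g a Z.≤ g z) (NP.m+[n∸m]≡n a≤b) (increasing-by g C inc (b ∸ a) a (subst (N._≤ C) (sym (NP.m+[n∸m]≡n a≤b)) b≤C))

  decreasing-by : ∀ (g : Series) j → (∀ i → j N.≤ i → g (suc i) Z.≤ g i) → ∀ d a → j N.≤ a → g (a N.+ d) Z.≤ g a
  decreasing-by g j dec zero a p = ZP.≤-reflexive (cong g (NP.+-identityʳ a))
  decreasing-by g j dec (suc d) a p = ZP.≤-trans (subst (λ z → g z Z.≤ g (a N.+ d)) (sym (NP.+-suc a d)) (dec (a N.+ d) (NP.≤-trans p (NP.m≤m+n a d))))
     (decreasing-by g j dec d a p)

  if-true : ∀ {A : Set} {b : Bool} {x y : A} → Bool.T b → (if b then x else y) ≡ x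
  if-true {b = true} _ = refl

  if-false : ∀ {A : Set} {b : Bool} {x y : A} → ¬ Bool.T b → (if b then x else y) ≡ y
  if-false {b = true} p = ⊥-elim (p tt)
  if-false {b = false} _ = refl

  shift-≥ : ∀ e a n → e N.≤ n → shiftBy e a n ≡ a (n ∸ e)
  shift-≥ e a n p = if-true (NP.≤⇒≤ᵇ p)

  shift-< : ∀ e a n → n N.< e → shiftBy e a n ≡ + 0
  shift-< e a n p = if-false (λ t → NP.<⇒≱ p (NP.≤ᵇ⇒≤ e n t))

  shift-zero : ∀ a n → shiftBy 0 a n ≡ a n
  shift-zero a n = shift-≥ 0 a n z≤n

  shift-cong : ∀ e {a b : Series} → a ≗ b → shiftBy e a ≗ shiftBy e b
  shift-cong e {a} {b} h n with e N.≤? n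
  ... | yes p = trans (shift-≥ e a n p) (trans (h (n ∸ e)) (sym (shift-≥ e b n p)))
  ... | no p = trans (shift-< e a n (NP.≰⇒> p)) (sym (shift-< e b n (NP.≰⇒> p)))

  shift-sub : ∀ e (a b : Series) n → shiftBy e (λ j → a j - b j) n ≡ shiftBy e a n - shiftBy e b n
  shift-sub e a b n with e N.≤? n
  ... | yes p rewrite shift-≥ e a n p | shift-≥ e b n p | shift-≥ e (λ j → a j - b j) n p = refl
  ... | no p rewrite shift-< e a n (NP.≰⇒> p) | shift-< e b n (NP.≰⇒> p) | shift-< e (λ j → a j - b j) n (NP.≰⇒> p) = refl

  shift-add : ∀ e (a b : Series) n → shiftBy e (λ j → a j + b j) n ≡ shiftBy e a n + shiftBy e b n
  shift-add e a b n with e N.≤? n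
  ... | yes p rewrite shift-≥ e a n p | shift-≥ e b n p | shift-≥ e (λ j → a j + b j) n p = refl
  ... | no p rewrite shift-< e a n (NP.≰⇒> p) | shift-< e b n (NP.≰⇒> p) | shift-< e (λ j → a j + b j) n (NP.≰⇒> p) = refl

  shift-shift : ∀ i j a n → shiftBy i (shiftBy j a) n ≡ shiftBy (i N.+ j) a n
  shift-shift i j a n with i N.≤? n
  ... | no p = trans (shift-< i (shiftBy j a) n (NP.≰⇒> p)) (sym (shift-< (i N.+ j) a n (NP.<-≤-trans (NP.≰⇒> p) (NP.m≤m+n i j))))
  ... | yes p with j N.≤? (n ∸ i)
  ...   | yes q = trans (shift-≥ i (shiftBy j a) n p) (trans (shift-≥ j a (n ∸ i) q)
                   (trans (cong a (NP.∸-+-assoc n i j)) (sym (shift-≥ (i N.+ j) a n ij≤n))))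
    where
    ij≤n : i N.+ j N.≤ n
    ij≤n = NP.≤-trans (NP.+-monoʳ-≤ i q) (NP.≤-reflexive (NP.m+[n∸m]≡n p))
  ...   | no q = trans (shift-≥ i (shiftBy j a) n p) (trans (shift-< j a (n ∸ i) (NP.≰⇒> q)) (sym (shift-< (i N.+ j) a n lt)))
    where
    lt : n N.< i N.+ j
    lt = NP.≤-trans (NP.≤-reflexive (cong suc (sym (NP.m+[n∸m]≡n p)))) (NP.≤-trans (NP.≤-reflexive (sym (NP.+-suc i (n ∸ i)))) (NP.+-monoʳ-≤ i (NP.≰⇒> q)))

  shift-of-zero : ∀ e n → shiftBy e (λ _ → + 0) n ≡ + 0
  shift-of-zero e n with e N.≤? n
  ... | yes p = shift-≥ e (λ _ → + 0) n p
  ... | no p = shift-< e (λ _ → + 0) n (NP.≰⇒> p)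

  shift-agree : ∀ e (A B : Series) n → (e N.≤ n → A (n ∸ e) ≡ B (n ∸ e)) → shiftBy e A n ≡ shiftBy e B n
  shift-agree e A B n h with e N.≤? n
  ... | yes p = trans (shift-≥ e A n p) (trans (h p) (sym (shift-≥ e B n p)))
  ... | no p = trans (shift-< e A n (NP.≰⇒> p)) (sym (shift-< e B n (NP.≰⇒> p)))

  shift-agree-below : ∀ s {x y : Series} n → 1 N.≤ s → (∀ j → j N.< n → x j ≡ y j) → shiftBy s x n ≡ shiftBy s y n
  shift-agree-below s {x} {y} n s1 h with s N.≤? n
  ... | yes p = trans (shift-≥ s x n p) (trans (h (n ∸ s) (NP.∸-monoʳ-< s1 p)) (sym (shift-≥ s y n p)))
  ... | no p = trans (shift-< s x n (NP.≰⇒> p)) (sym (shift-< s y n (NP.≰⇒> p)))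

  mulOneMinus-cong : ∀ i {a b : Series} → a ≗ b → mulOneMinus i a ≗ mulOneMinus i b
  mulOneMinus-cong i {a} {b} h n = cong₂ _-_ (h n) (shift-cong i h n)

  sumTo-cong : ∀ t {f g : ℕ → ℤ} → (∀ x → f x ≡ g x) → sumTo t f ≡ sumTo t g
  sumTo-cong zero h = h 0
  sumTo-cong (suc t) h = cong₂ _+_ (sumTo-cong t h) (h (suc t))

  divOneMinus-cong : ∀ j {a b : Series} → a ≗ b → divOneMinusSuc j a ≗ divOneMinusSuc j b
  divOneMinus-cong j h n = sumTo-cong (n N./ suc j) (λ t → h _)

  sumTo-front : ∀ t (g : ℕ → ℤ) → sumTo (suc t) g ≡ g 0 + sumTo t (λ x → g (suc x))
  sumTo-front zero g = refl
  sumTo-front (suc t) g = trans (cong (_+ g (suc (suc t))) (sumTo-front t g)) (ZP.+-assoc (g 0) _ _)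

  divOneMinus-small : ∀ j a n → n N.< suc j → divOneMinusSuc j a n ≡ a n
  divOneMinus-small j a n p rewrite m<n⇒m/n≡0 {n} {suc j} p = refl

  divOneMinus-step : ∀ j a n → suc j N.≤ n → divOneMinusSuc j a n ≡ a n + divOneMinusSuc j a (n ∸ suc j)
  divOneMinus-step j a n p rewrite m/n≡1+[m∸n]/n {n} {suc j} p =
    trans (sumTo-front ((n ∸ suc j) N./ suc j) _)
          (cong (λ z → a n + z) (sumTo-cong ((n ∸ suc j) N./ suc j) (λ t → cong a (sym (NP.∸-+-assoc n (suc j) (t N.* suc j))))))

  mul-div-cancel : ∀ j a → mulOneMinus (suc j) (divOneMinusSuc j a) ≗ a
  mul-div-cancel j a n with suc j N.≤? n
  ... | yes p rewrite shift-≥ (suc j) (divOneMinusSuc j a) n p | divOneMinus-step j a n p = lem (a n) _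
    where
    lem : ∀ x y → x + y - y ≡ x
    lem = solve-∀
  ... | no p rewrite shift-< (suc j) (divOneMinusSuc j a) n (NP.≰⇒> p) | divOneMinus-small j a n (NP.≰⇒> p) = ZP.+-identityʳ (a n)

  -- Multiplication by (1 - q^(j+1)) is injective on power series: degree by
  -- degree, x n = ((1 - q^(j+1)) x) n + x (n - j - 1).
  mulOneMinus-injective : ∀ j {x y : Series} → mulOneMinus (suc j) x ≗ mulOneMinus (suc j) y → x ≗ y
  mulOneMinus-injective j {x} {y} h n = agree-below (suc n) n (NP.n<1+n n)
    where
    lem : ∀ a b → a ≡ (a - b) + b
    lem = solve-∀
    agree-below : ∀ m i → i N.< m → x i ≡ y i
    agree-below (suc m) i i<m with NP.m<1+n⇒m<n∨m≡n i<m
    ... | inj₁ q = agree-below m i q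
    ... | inj₂ refl = begin
        x i ≡⟨ lem (x i) (shiftBy (suc j) x i) ⟩
        mulOneMinus (suc j) x i + shiftBy (suc j) x i ≡⟨ cong₂ _+_ (h i) (shift-agree-below (suc j) i (s≤s z≤n) (agree-below m)) ⟩
        mulOneMinus (suc j) y i + shiftBy (suc j) y i ≡⟨ sym (lem (y i) (shiftBy (suc j) y i)) ⟩
        y i ∎
      where open ≡-Reasoning

  div-mul-cancel : ∀ j a → divOneMinusSuc j (mulOneMinus (suc j) a) ≗ a
  div-mul-cancel j a = mulOneMinus-injective j (mul-div-cancel j (mulOneMinus (suc j) a))

  divOneMinus-unique : ∀ j {X Y : Series} → mulOneMinus (suc j) X ≗ Y → X ≗ divOneMinusSuc j Y
  divOneMinus-unique j {X} {Y} h = ≗-trans (≗-sym (div-mul-cancel j X)) (divOneMinus-cong j h)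

  mulOneMinus-twice : ∀ i j a n → mulOneMinus i (mulOneMinus j a) n ≡ a n - shiftBy j a n - (shiftBy i a n - shiftBy (i N.+ j) a n)
  mulOneMinus-twice i j a n = cong (λ z → a n - shiftBy j a n - z) (trans (shift-sub i a (shiftBy j a) n) (cong (λ z → shiftBy i a n - z) (shift-shift i j a n)))

  mulOneMinus-comm : ∀ i j a → mulOneMinus i (mulOneMinus j a) ≗ mulOneMinus j (mulOneMinus i a)
  mulOneMinus-comm i j a n = begin
    mulOneMinus i (mulOneMinus j a) n                            ≡⟨ mulOneMinus-twice i j a n ⟩
    a n - shiftBy j a n - (shiftBy i a n - shiftBy (i N.+ j) a n) ≡⟨ cong (λ z → a n - shiftBy j a n - (shiftBy i a n - shiftBy z a n)) (NP.+-comm i j) ⟩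
    a n - shiftBy j a n - (shiftBy i a n - shiftBy (j N.+ i) a n) ≡⟨ swap (a n) (shiftBy j a n) (shiftBy i a n) (shiftBy (j N.+ i) a n) ⟩
    a n - shiftBy i a n - (shiftBy j a n - shiftBy (j N.+ i) a n) ≡⟨ sym (mulOneMinus-twice j i a n) ⟩
    mulOneMinus j (mulOneMinus i a) n                            ∎
    where
    open ≡-Reasoning
    swap : ∀ x p q r → x - p - (q - r) ≡ x - q - (p - r)
    swap = solve-∀

  mul-div-comm : ∀ i j a → mulOneMinus i (divOneMinusSuc j a) ≗ divOneMinusSuc j (mulOneMinus i a)
  mul-div-comm i j a = mulOneMinus-injective j {mulOneMinus i (divOneMinusSuc j a)} (λ n →
    trans (mulOneMinus-comm (suc j) i (divOneMinusSuc j a) n)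
          (trans (mulOneMinus-cong i (mul-div-cancel j a) n) (sym (mul-div-cancel j (mulOneMinus i a) n))))

  mulOneMinus-split : ∀ i j a n → mulOneMinus (i N.+ j) a n ≡ mulOneMinus i a n + shiftBy i (mulOneMinus j a) n
  mulOneMinus-split i j a n rewrite shift-sub i a (shiftBy j a) n | shift-shift i j a n = lem (a n) _ _
    where
    lem : ∀ x p q → x - q ≡ x - p + (p - q)
    lem = solve-∀

  divProd-cong : ∀ k {a b : Series} → a ≗ b → divProd k a ≗ divProd k b
  divProd-cong zero h = h
  divProd-cong (suc k) h = divOneMinus-cong k (divProd-cong k h)

  mulOneMinus-divProd : ∀ i k a → mulOneMinus i (divProd k a) ≗ divProd k (mulOneMinus i a)
  mulOneMinus-divProd i zero a n = refl
  mulOneMinus-divProd i (suc k) a = ≗-trans (mul-div-comm i k (divProd k a)) (divOneMinus-cong k (mulOneMinus-divProd i k a))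

  divProd-mulProd : ∀ k m a → divProd k (mulProd m a) ≗ mulProd m (divProd k a)
  divProd-mulProd k zero a n = refl
  divProd-mulProd k (suc m) a = ≗-trans (≗-sym (mulOneMinus-divProd (suc m) k (mulProd m a))) (mulOneMinus-cong (suc m) (divProd-mulProd k m a))

  divProd-mulProd-cancel : ∀ m a → divProd m (mulProd m a) ≗ a
  divProd-mulProd-cancel zero a n = refl
  divProd-mulProd-cancel (suc m) a = ≗-trans (divOneMinus-cong m (≗-sym (mulOneMinus-divProd (suc m) m (mulProd m a))))
     (≗-trans (divOneMinus-cong m (mulOneMinus-cong (suc m) (divProd-mulProd-cancel m a))) (div-mul-cancel m a))

  -- The Gaussian polynomial [k+s choose k]_q, written with both bottom entries
  -- free: for m = k + s we have qbinom m k = gauss k s by computation.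
  gauss : ℕ → ℕ → Series
  gauss k s = divProd s (divProd k (mulProd (k N.+ s) one))

  mulProd-at-zero : ∀ m a → mulProd m a 0 ≡ a 0
  mulProd-at-zero zero a = refl
  mulProd-at-zero (suc m) a = trans (ZP.+-identityʳ (mulProd m a 0)) (mulProd-at-zero m a)

  divProd-at-zero : ∀ k a → divProd k a 0 ≡ a 0
  divProd-at-zero zero a = refl
  divProd-at-zero (suc k) a = divProd-at-zero k a

  gauss-at-zero : ∀ k s → gauss k s 0 ≡ + 1
  gauss-at-zero k s = trans (divProd-at-zero s _) (trans (divProd-at-zero k _) (mulProd-at-zero (k N.+ s) one))

  gauss-zero-left : ∀ s → gauss 0 s ≗ one
  gauss-zero-left s = divProd-mulProd-cancel s one

  gauss-zero-right : ∀ k → gauss k 0 ≗ one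
  gauss-zero-right k rewrite NP.+-identityʳ k = divProd-mulProd-cancel k one

  -- The two q-Pascal recurrences
  --   [k+1+r+1 choose k+1] = [k+r+1 choose k] + q^(k+1) [k+1+r choose k+1]
  --                       = [k+1+r choose k+1] + q^(r+1) [k+r+1 choose k],
  -- both from splitting the top factor 1 - q^(k+r+2) by mulOneMinus-split.
  module Pascal (k r : ℕ) where
    W : Series
    W = mulProd (k N.+ suc r) one
    X : Series
    X = divProd (suc r) (divProd (suc k) W)
    as-quotient : gauss (suc k) (suc r) ≗ mulOneMinus (suc k N.+ suc r) X
    as-quotient = ≗-trans (divProd-cong (suc r) (≗-sym (mulOneMinus-divProd (suc k N.+ suc r) (suc k) W)))
                   (≗-sym (mulOneMinus-divProd (suc k N.+ suc r) (suc r) (divProd (suc k) W)))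
    remove-first : mulOneMinus (suc k) X ≗ gauss k (suc r)
    remove-first = ≗-trans (mulOneMinus-divProd (suc k) (suc r) (divProd (suc k) W)) (divProd-cong (suc r) (mul-div-cancel k (divProd k W)))
    remove-second : mulOneMinus (suc r) X ≗ gauss (suc k) r
    remove-second n = trans (mul-div-cancel r (divProd r (divProd (suc k) W)) n)
       (cong (λ z → divProd r (divProd (suc k) (mulProd z one)) n) (NP.+-suc k r))
    pascal1 : ∀ n → gauss (suc k) (suc r) n ≡ gauss k (suc r) n + shiftBy (suc k) (gauss (suc k) r) n
    pascal1 n = trans (as-quotient n) (trans (mulOneMinus-split (suc k) (suc r) X n) (cong₂ _+_ (remove-first n) (shift-cong (suc k) remove-second n)))
    pascal2 : ∀ n → gauss (suc k) (suc r) n ≡ gauss (suc k) r n + shiftBy (suc r) (gauss k (suc r)) n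
    pascal2 n = trans (as-quotient n) (trans (cong (λ z → mulOneMinus z X n) (NP.+-comm (suc k) (suc r)))
       (trans (mulOneMinus-split (suc r) (suc k) X n) (cong₂ _+_ (remove-second n) (shift-cong (suc r) remove-first n))))

  -- A series is palindromic of degree D if it vanishes above D and its
  -- coefficients are symmetric about D/2.  This is the common shape of all the
  -- series in the theorem, and it reduces unimodality to the lower half.
  SymmetricAbout : Series → ℕ → Set
  SymmetricAbout g D = ∀ n → n N.≤ D → g n ≡ g (D ∸ n)

  VanishesAbove : Series → ℕ → Set
  VanishesAbove g D = ∀ n → D N.< n → g n ≡ + 0

  Palindromic : Series → ℕ → Set
  Palindromic g D = SymmetricAbout g D × VanishesAbove g D

  palindromic-≗ : ∀ {a b : Series} D → a ≗ b → Palindromic a D → Palindromic b D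
  palindromic-≗ D h (s , z) = (λ n p → trans (sym (h n)) (trans (s n p) (h (D ∸ n)))) , (λ n p → trans (sym (h n)) (z n p))

  palindromic-one : Palindromic one 0
  palindromic-one = (λ { zero _ → refl }) , (λ { (suc n) _ → refl })

  shift-vanishes-outside : ∀ e (X : Series) D' → VanishesAbove X D' → ∀ n → n N.< e ⊎ e N.+ D' N.< n → shiftBy e X n ≡ + 0
  shift-vanishes-outside e X D' zx n (inj₁ n<e) = shift-< e X n n<e
  shift-vanishes-outside e X D' zx n (inj₂ e+D'<n) = trans (shift-≥ e X n e≤n) (zx (n ∸ e) D'<n∸e)
    where
    e≤n : e N.≤ n
    e≤n = NP.≤-trans (NP.m≤m+n e D') (NP.<⇒≤ e+D'<n)
    D'<n∸e : D' N.< n ∸ e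
    D'<n∸e = NP.+-cancelˡ-< e D' (n ∸ e) (subst (e N.+ D' N.<_) (sym (NP.m+[n∸m]≡n e≤n)) e+D'<n)

  -- Reading q^c X backwards from degree c + D' reads X backwards from D',
  -- which by symmetry of X gives X again.
  shift-mirror : ∀ c (X : Series) D' → Palindromic X D' → ∀ n → n N.≤ c N.+ D' → shiftBy c X n ≡ X (c N.+ D' ∸ n)
  shift-mirror c X D' (sx , zx) n n≤c+D' with c N.≤? n
  ... | yes c≤n = trans (shift-≥ c X n c≤n) (trans (sx (n ∸ c) n∸c≤D') (cong X (sym c+D'∸n)))
    where
    n∸c≤D' : n ∸ c N.≤ D'
    n∸c≤D' = subst (n ∸ c N.≤_) (NP.m+n∸m≡n c D') (NP.∸-monoˡ-≤ c n≤c+D')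
    c+D'∸n : c N.+ D' ∸ n ≡ D' ∸ (n ∸ c)
    c+D'∸n = trans (cong (c N.+ D' ∸_) (sym (NP.m+[n∸m]≡n c≤n))) (NP.[m+n]∸[m+o]≡n∸o c D' (n ∸ c))
  ... | no c≰n = trans (shift-< c X n (NP.≰⇒> c≰n)) (sym (zx (c N.+ D' ∸ n) D'<c+D'∸n))
    where
    D'<c+D'∸n : D' N.< c N.+ D' ∸ n
    D'<c+D'∸n = subst (N._< c N.+ D' ∸ n) (NP.m+n∸m≡n c D') (NP.∸-monoʳ-< (NP.≰⇒> c≰n) (NP.m≤m+n c D'))

  palindromic-pascal : ∀ (A B Qs : Series) (kk r DA DB : ℕ) →
    (∀ n → Qs n ≡ A n + shiftBy kk B n) → (∀ n → Qs n ≡ B n + shiftBy (suc r) A n) →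
    Palindromic A DA → Palindromic B DB → suc r N.+ DA ≡ kk N.+ DB → Palindromic Qs (suc r N.+ DA)
  palindromic-pascal A B Qs kk r DA DB Q≡A+B Q≡B+A pal-A@(_ , zA) pal-B@(_ , zB) D≡kk+DB = symm , zer
    where
    D : ℕ
    D = suc r N.+ DA
    -- Under n ↦ D - n the A-part of the first recurrence becomes the A-part of
    -- the second, and likewise for B.
    mirror-A : ∀ n → n N.≤ D → A n ≡ shiftBy (suc r) A (D ∸ n)
    mirror-A n n≤D = sym (trans (shift-mirror (suc r) A DA pal-A (D ∸ n) (NP.m∸n≤m D n)) (cong A (NP.m∸[m∸n]≡n n≤D)))
    mirror-B : ∀ n → n N.≤ D → shiftBy kk B n ≡ B (D ∸ n)
    mirror-B n n≤D = trans (shift-mirror kk B DB pal-B n (subst (n N.≤_) D≡kk+DB n≤D)) (cong (λ z → B (z ∸ n)) (sym D≡kk+DB))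
    symm : SymmetricAbout Qs D
    symm n n≤D = trans (Q≡A+B n) (trans (cong₂ _+_ (mirror-A n n≤D) (mirror-B n n≤D))
      (trans (ZP.+-comm (shiftBy (suc r) A (D ∸ n)) (B (D ∸ n))) (sym (Q≡B+A (D ∸ n)))))
    zer : VanishesAbove Qs D
    zer n D<n = trans (Q≡A+B n) (cong₂ _+_ (zA n (NP.≤-<-trans (NP.m≤n+m DA (suc r)) D<n))
      (shift-vanishes-outside kk B DB zB n (inj₂ (subst (N._< n) D≡kk+DB D<n))))

  gauss-palindromic : ∀ k s → Palindromic (gauss k s) (k N.* s)
  gauss-palindromic zero s = palindromic-≗ 0 (≗-sym (gauss-zero-left s)) palindromic-one
  gauss-palindromic (suc k) zero = subst (Palindromic (gauss (suc k) 0)) (sym (NP.*-zeroʳ k)) (palindromic-≗ 0 (≗-sym (gauss-zero-right (suc k))) palindromic-one)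
  gauss-palindromic (suc k) (suc r) = palindromic-pascal (gauss k (suc r)) (gauss (suc k) r) (gauss (suc k) (suc r)) (suc k) r (k N.* suc r) (suc k N.* r)
     (Pascal.pascal1 k r) (Pascal.pascal2 k r) (gauss-palindromic k (suc r)) (gauss-palindromic (suc k) r) (NP.*-suc (suc k) r)

  palindromic-sub : ∀ {A B : Series} D → Palindromic A D → Palindromic B D → Palindromic (λ n → A n - B n) D
  palindromic-sub D (sa , za) (sb , zb) = (λ n p → cong₂ _-_ (sa n p) (sb n p)) , (λ n p → trans (cong₂ _-_ (za n p) (zb n p)) refl)

  mirror-outside : ∀ e D' n → n N.≤ e N.+ (e N.+ D') → n N.< e ⊎ e N.+ D' N.< n →
    e N.+ (e N.+ D') ∸ n N.< e ⊎ e N.+ D' N.< e N.+ (e N.+ D') ∸ n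
  mirror-outside e D' n n≤T (inj₁ n<e) =
    inj₂ (subst (N._< e N.+ (e N.+ D') ∸ n) (NP.m+n∸m≡n e (e N.+ D')) (NP.∸-monoʳ-< n<e (NP.m≤m+n e (e N.+ D'))))
  mirror-outside e D' n n≤T (inj₂ e+D'<n) =
    inj₁ (subst (e N.+ (e N.+ D') ∸ n N.<_) (NP.m+n∸n≡m e (e N.+ D')) (NP.∸-monoʳ-< e+D'<n n≤T))

  -- q^e X is palindromic of degree 2e + D' when X is palindromic of degree D'.
  -- With palindromic-sub this makes f(k,m,b) palindromic of degree k(m-k).
  palindromic-shift : ∀ e (X : Series) D' → Palindromic X D' → Palindromic (shiftBy e X) (e N.+ (e N.+ D'))
  palindromic-shift e X D' (sx , zx) = symm , λ n T<n → shift-vanishes-outside e X D' zx n (inj₂ (NP.≤-<-trans (NP.m≤n+m (e N.+ D') e) T<n))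
    where
    T : ℕ
    T = e N.+ (e N.+ D')
    middle : ∀ n → e N.≤ n → n ∸ e N.≤ D' → shiftBy e X n ≡ shiftBy e X (T ∸ n)
    middle n e≤n n∸e≤D' = trans (shift-≥ e X n e≤n) (trans (sx (n ∸ e) n∸e≤D') (sym (trans (shift-≥ e X (T ∸ n) e≤T∸n) (cong X T∸n∸e))))
      where
      T∸n : T ∸ n ≡ e N.+ (D' ∸ (n ∸ e))
      T∸n = trans (cong (T ∸_) (sym (NP.m+[n∸m]≡n e≤n))) (trans (NP.[m+n]∸[m+o]≡n∸o e (e N.+ D') (n ∸ e)) (NP.+-∸-assoc e n∸e≤D'))
      e≤T∸n : e N.≤ T ∸ n
      e≤T∸n = subst (e N.≤_) (sym T∸n) (NP.m≤m+n e _)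
      T∸n∸e : T ∸ n ∸ e ≡ D' ∸ (n ∸ e)
      T∸n∸e = trans (cong (_∸ e) T∸n) (NP.m+n∸m≡n e _)
    outside : ∀ n → n N.≤ T → n N.< e ⊎ e N.+ D' N.< n → shiftBy e X n ≡ shiftBy e X (T ∸ n)
    outside n n≤T o = trans (shift-vanishes-outside e X D' zx n o) (sym (shift-vanishes-outside e X D' zx (T ∸ n) (mirror-outside e D' n n≤T o)))
    symm : SymmetricAbout (shiftBy e X) T
    symm n n≤T with e N.≤? n | n ∸ e N.≤? D'
    ... | yes e≤n | yes n∸e≤D' = middle n e≤n n∸e≤D'
    ... | no e≰n | _ = outside n n≤T (inj₁ (NP.≰⇒> e≰n))
    ... | yes e≤n | no n∸e≰D' = outside n n≤T (inj₂ (subst (e N.+ D' N.<_) (NP.m+[n∸m]≡n e≤n) (NP.+-monoʳ-< e (NP.≰⇒> n∸e≰D'))))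

  -- mulRange k s Y = (1 - q^(s+1)) ⋯ (1 - q^(s+k)) Y, the factors of the
  -- numerator of [k+s choose k] that are not cancelled by the denominator.
  mulRange : ℕ → ℕ → Series → Series
  mulRange zero s y = y
  mulRange (suc k) s y = mulOneMinus (suc (k N.+ s)) (mulRange k s y)

  mulProd-as-mulRange : ∀ k s a → mulProd (k N.+ s) a ≡ mulRange k s (mulProd s a)
  mulProd-as-mulRange zero s a = refl
  mulProd-as-mulRange (suc k) s a = cong (mulOneMinus (suc (k N.+ s))) (mulProd-as-mulRange k s a)

  mulRange-cong : ∀ k s {a b : Series} → a ≗ b → mulRange k s a ≗ mulRange k s b
  mulRange-cong zero s h = h
  mulRange-cong (suc k) s h = mulOneMinus-cong (suc (k N.+ s)) (mulRange-cong k s h)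

  divProd-mulRange : ∀ d k s y → divProd d (mulRange k s y) ≗ mulRange k s (divProd d y)
  divProd-mulRange d zero s y n = refl
  divProd-mulRange d (suc k) s y = ≗-trans (≗-sym (mulOneMinus-divProd (suc (k N.+ s)) d (mulRange k s y))) (mulOneMinus-cong (suc (k N.+ s)) (divProd-mulRange d k s y))

  mulOneMinus-mulRange : ∀ i k s y → mulOneMinus i (mulRange k s y) ≗ mulRange k s (mulOneMinus i y)
  mulOneMinus-mulRange i zero s y n = refl
  mulOneMinus-mulRange i (suc k) s y = ≗-trans (mulOneMinus-comm i (suc (k N.+ s)) (mulRange k s y)) (mulOneMinus-cong (suc (k N.+ s)) (mulOneMinus-mulRange i k s y))

  gauss-as-mulRange : ∀ k s → gauss k s ≗ mulRange k s (divProd k one)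
  gauss-as-mulRange k s n = trans (cong (λ z → divProd s (divProd k z) n) (mulProd-as-mulRange k s one))
    (trans (divProd-cong s (divProd-mulRange k k s (mulProd s one)) n)
    (trans (divProd-mulRange s k s (divProd k (mulProd s one)) n)
    (mulRange-cong k s (≗-trans (divProd-cong s (divProd-mulProd k s one)) (divProd-mulProd-cancel s (divProd k one))) n)))

  -- divRange s k a = a / ((1 - q^(s+1)) ⋯ (1 - q^(s+k))).  In particular
  -- partsFrom2 k = 1/((1 - q^2) ⋯ (1 - q^(k+1))) counts partitions into parts
  -- from {2, …, k+1}.
  divRange : ℕ → ℕ → Series → Series
  divRange s zero a = a
  divRange s (suc k) a = divOneMinusSuc (s N.+ k) (divRange s k a)

  divRange-cong : ∀ s k {a b : Series} → a ≗ b → divRange s k a ≗ divRange s k b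
  divRange-cong s zero h = h
  divRange-cong s (suc k) h = divOneMinus-cong (s N.+ k) (divRange-cong s k h)

  divProd-as-divRange : ∀ k a → divProd (suc k) a ≗ divRange 1 k (divOneMinusSuc 0 a)
  divProd-as-divRange zero a n = refl
  divProd-as-divRange (suc k) a = divOneMinus-cong (suc k) (divProd-as-divRange k a)

  mulOneMinus-divRange : ∀ i s k a → mulOneMinus i (divRange s k a) ≗ divRange s k (mulOneMinus i a)
  mulOneMinus-divRange i s zero a n = refl
  mulOneMinus-divRange i s (suc k) a = ≗-trans (mul-div-comm i (s N.+ k) (divRange s k a)) (divOneMinus-cong (s N.+ k) (mulOneMinus-divRange i s k a))

  partsFrom2 : ℕ → Series
  partsFrom2 k = divRange 1 k one

  difference-divProd : ∀ k a → mulOneMinus 1 (divProd (suc k) a) ≗ divRange 1 k a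
  difference-divProd k a = ≗-trans (mulOneMinus-cong 1 (divProd-as-divRange k a)) (≗-trans (mulOneMinus-divRange 1 1 k (divOneMinusSuc 0 a)) (divRange-cong 1 k (mul-div-cancel 0 a)))

  geometricSum : ℕ → Series → Series
  geometricSum zero X n = + 0
  geometricSum (suc k) X n = geometricSum k X n + shiftBy k X n

  -- In degrees n ≤ 2s+1 only the linear terms of (1 - q^(s+1)) ⋯ (1 - q^(s+k))
  -- contribute (any product of two of the q^(s+i) has degree ≥ 2s+3):
  -- there the product acts as Y ↦ Y - q^(s+1)(1 + q + ⋯ + q^(k-1)) Y.
  mulRange-low : ∀ k s Y j → j N.≤ s → mulRange k s Y j ≡ Y j
  mulRange-low zero s Y j p = refl
  mulRange-low (suc k) s Y j p = trans (cong (_-_ (mulRange k s Y j)) (shift-< (suc (k N.+ s)) (mulRange k s Y) j (s≤s (NP.≤-trans p (NP.m≤n+m s k)))))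
     (trans (ZP.+-identityʳ _) (mulRange-low k s Y j p))

  mulRange-low-degrees : ∀ k s Y n → n N.≤ suc (s N.+ s) → mulRange k s Y n ≡ Y n - shiftBy (suc s) (geometricSum k Y) n
  mulRange-low-degrees zero s Y n p = sym (trans (cong (_-_ (Y n)) (shift-of-zero (suc s) n)) (ZP.+-identityʳ (Y n)))
  mulRange-low-degrees (suc k) s Y n p =
    trans (cong₂ _-_ (mulRange-low-degrees k s Y n p) (shift-agree (suc (k N.+ s)) (mulRange k s Y) Y n (λ q → mulRange-low k s Y _ (le q))))
    (trans (lem (Y n) _ _)
    (cong (_-_ (Y n)) (sym (trans (shift-add (suc s) (geometricSum k Y) (shiftBy k Y) n)
         (cong (_+_ (shiftBy (suc s) (geometricSum k Y) n)) (trans (shift-shift (suc s) k Y n) (cong (λ z → shiftBy (suc z) Y n) (NP.+-comm s k))))))))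
    where
    lem : ∀ y a b → y - a - b ≡ y - (a + b)
    lem = solve-∀
    le : suc (k N.+ s) N.≤ n → n ∸ suc (k N.+ s) N.≤ s
    le q = NP.≤-trans (NP.∸-monoʳ-≤ n (s≤s (NP.m≤n+m s k))) (NP.≤-trans (NP.∸-monoˡ-≤ (suc s) p)
             (NP.≤-reflexive (trans (cong (_∸ suc s) (sym (NP.+-suc s s))) (NP.m+n∸n≡m s (suc s)))))

  difference-geometricSum : ∀ k X → mulOneMinus 1 (geometricSum k X) ≗ mulOneMinus k X
  difference-geometricSum zero X n = trans (cong (_-_ (+ 0)) (shift-of-zero 1 n)) (sym (trans (cong (_-_ (X n)) (shift-zero X n)) (ZP.+-inverseʳ (X n))))
  difference-geometricSum (suc k) X n = trans (cong (_-_ (geometricSum k X n + shiftBy k X n)) (shift-add 1 (geometricSum k X) (shiftBy k X) n))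
     (trans (lem (geometricSum k X n) _ _ _) (trans (cong₂ _+_ (difference-geometricSum k X n) (cong (_-_ (shiftBy k X n)) (shift-shift 1 k X n)))
     (lem2 (X n) _ _)))
    where
    lem : ∀ a b c d → a + b - (c + d) ≡ (a - c) + (b - d)
    lem = solve-∀
    lem2 : ∀ x a b → x - a + (a - b) ≡ x - b
    lem2 = solve-∀

  geometricSum-partsFrom2 : ∀ k → geometricSum (suc k) (partsFrom2 k) ≗ divProd k one
  geometricSum-partsFrom2 zero n = trans (ZP.+-identityˡ _) (shift-zero one n)
  geometricSum-partsFrom2 (suc k) = mulOneMinus-injective 0 (≗-trans (difference-geometricSum (suc (suc k)) (partsFrom2 (suc k)))
     (≗-trans (mul-div-cancel (suc k) (divRange 1 k one)) (≗-sym (difference-divProd k one))))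

  -- Together with symmetry this controls f on its lower half.
  difference-gauss-low : ∀ k s n → n N.≤ suc (s N.+ s) → mulOneMinus 1 (gauss (suc k) s) n ≡ partsFrom2 k n - shiftBy (suc s) (divProd k one) n
  difference-gauss-low k s n p = trans (mulOneMinus-cong 1 (gauss-as-mulRange (suc k) s) n) (trans (mulOneMinus-mulRange 1 (suc k) s (divProd (suc k) one) n)
    (trans (mulRange-cong (suc k) s (difference-divProd k one) n) (trans (mulRange-low-degrees (suc k) s (partsFrom2 k) n p)
    (cong (_-_ (partsFrom2 k n)) (shift-cong (suc s) (geometricSum-partsFrom2 k) n)))))

  -- Explicit partition counts with small part sizes, each identified with the
  -- corresponding generating function by checking its recurrence
  -- (divOneMinus-unique).  Names record the allowed part sizes.
  natSeries : (ℕ → ℕ) → Series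
  natSeries f n = + f n

  ones : Series
  ones _ = + 1

  ones-gen : ones ≗ divOneMinusSuc 0 one
  ones-gen = divOneMinus-unique 0 {ones} {one} λ { zero → refl ; (suc n) → refl }

  one-above-zero : ∀ k → k ≢ 0 → one k ≡ + 0
  one-above-zero zero p = ⊥-elim (p refl)
  one-above-zero (suc k) p = refl

  parts2 : ℕ → ℕ
  parts2 zero = 1
  parts2 (suc zero) = 0
  parts2 (suc (suc n)) = parts2 n

  parts2-gen : natSeries parts2 ≗ partsFrom2 1
  parts2-gen = divOneMinus-unique 1 lem
    where
    lem : mulOneMinus 2 (natSeries parts2) ≗ one
    lem zero = refl
    lem (suc zero) = refl
    lem (suc (suc n)) = ZP.+-inverseʳ (+ parts2 n)

  parts2-even : ∀ t → parts2 (t N.+ t) ≡ 1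
  parts2-even zero = refl
  parts2-even (suc t) = trans (cong parts2 (NP.+-suc (suc t) t)) (parts2-even t)

  parts2-odd : ∀ t → parts2 (suc (t N.+ t)) ≡ 0
  parts2-odd zero = refl
  parts2-odd (suc t) = trans (cong (λ z → parts2 (suc z)) (NP.+-suc (suc t) t)) (parts2-odd t)

  parts2≤1 : ∀ n → parts2 n N.≤ 1
  parts2≤1 zero = s≤s z≤n
  parts2≤1 (suc zero) = z≤n
  parts2≤1 (suc (suc n)) = parts2≤1 n

  parts12 : ℕ → ℕ
  parts12 zero = 1
  parts12 (suc zero) = 1
  parts12 (suc (suc n)) = suc (parts12 n)

  parts12-gen : natSeries parts12 ≗ divProd 2 one
  parts12-gen = ≗-trans (divOneMinus-unique 1 lem) (divOneMinus-cong 1 ones-gen)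
    where
    lem : mulOneMinus 2 (natSeries parts12) ≗ ones
    lem zero = refl
    lem (suc zero) = refl
    lem (suc (suc n)) = suc-sub (+ parts12 n)

  parts23 : ℕ → ℕ
  parts23 0 = 1
  parts23 1 = 0
  parts23 2 = 1
  parts23 3 = 1
  parts23 4 = 1
  parts23 5 = 1
  parts23 (suc (suc (suc (suc (suc (suc n)))))) = suc (parts23 n)

  parts23-gen : natSeries parts23 ≗ partsFrom2 2
  parts23-gen = ≗-trans (divOneMinus-unique 2 lem) (divOneMinus-cong 2 parts2-gen)
    where
    lem : mulOneMinus 3 (natSeries parts23) ≗ natSeries parts2
    lem 0 = refl
    lem 1 = refl
    lem 2 = refl
    lem 3 = refl
    lem 4 = refl
    lem 5 = refl
    lem 6 = refl
    lem 7 = refl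
    lem 8 = refl
    lem (suc (suc (suc (suc (suc (suc (suc (suc (suc n))))))))) =
      trans (suc-sub-suc (+ parts23 (suc (suc (suc n)))) (+ parts23 n)) (lem (suc (suc (suc n))))

  parts23-pos : ∀ n → n ≢ 1 → 1 N.≤ parts23 n
  parts23-pos 0 _ = s≤s z≤n
  parts23-pos 1 p = ⊥-elim (p refl)
  parts23-pos 2 _ = s≤s z≤n
  parts23-pos 3 _ = s≤s z≤n
  parts23-pos 4 _ = s≤s z≤n
  parts23-pos 5 _ = s≤s z≤n
  parts23-pos (suc (suc (suc (suc (suc (suc n)))))) _ = s≤s z≤n

  parts23-≥2 : ∀ n → 6 N.≤ n → n ≢ 7 → 2 N.≤ parts23 n
  parts23-≥2 (suc (suc (suc (suc (suc (suc n)))))) (s≤s (s≤s (s≤s (s≤s (s≤s (s≤s _)))))) p = s≤s (parts23-pos n (λ e → p (cong (λ z → 6 N.+ z) e)))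

  parts13 : ℕ → ℕ
  parts13 0 = 1
  parts13 1 = 1
  parts13 2 = 1
  parts13 (suc (suc (suc n))) = suc (parts13 n)

  parts13-gen : natSeries parts13 ≗ divOneMinusSuc 2 ones
  parts13-gen = divOneMinus-unique 2 lem
    where
    lem : mulOneMinus 3 (natSeries parts13) ≗ ones
    lem 0 = refl
    lem 1 = refl
    lem 2 = refl
    lem (suc (suc (suc n))) = suc-sub (+ parts13 n)

  parts123 : Series
  parts123 = divProd 3 one

  difference2-parts123 : mulOneMinus 2 parts123 ≗ natSeries parts13
  difference2-parts123 = ≗-trans (mul-div-comm 2 2 (divProd 2 one))
    (≗-trans (divOneMinus-cong 2 (mul-div-cancel 1 (divProd 1 one))) (≗-trans (divOneMinus-cong 2 (≗-sym ones-gen)) (≗-sym parts13-gen)))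

  difference1-parts123 : mulOneMinus 1 parts123 ≗ natSeries parts23
  difference1-parts123 = ≗-trans (difference-divProd 2 one) (≗-sym parts23-gen)

  parts123-suc : ∀ x → parts123 (suc x) ≡ parts123 x + + parts23 (suc x)
  parts123-suc x = trans (sym (lem (parts123 (suc x)) (parts123 x))) (cong (_+_ (parts123 x)) (difference1-parts123 (suc x)))
    where
    lem : ∀ a b → b + (a - b) ≡ a
    lem = solve-∀

  parts123-suc-suc : ∀ x → parts123 (suc (suc x)) ≡ parts123 x + + parts13 (suc (suc x))
  parts123-suc-suc x = trans (sym (lem (parts123 (suc (suc x))) (parts123 x))) (cong (_+_ (parts123 x)) (difference2-parts123 (suc (suc x))))
    where
    lem : ∀ a b → b + (a - b) ≡ a
    lem = solve-∀

  parts123-step : ∀ x → parts123 x Z.≤ parts123 (suc x)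
  parts123-step x = subst (parts123 x Z.≤_) (sym (parts123-suc x)) (ZP.i≤i+j (parts123 x) (+ parts23 (suc x)))

  parts123-mono : ∀ a b → a N.≤ b → parts123 a Z.≤ parts123 b
  parts123-mono a b p = increasing-between parts123 b (λ n _ → parts123-step n) a b p NP.≤-refl

  parts123-pos : ∀ x → + 1 Z.≤ parts123 x
  parts123-pos x = parts123-mono 0 x z≤n

  parts123-strict : ∀ y → parts123 (suc y) + + 1 Z.≤ parts123 (suc (suc y))
  parts123-strict y = subst (parts123 (suc y) + + 1 Z.≤_) (sym (parts123-suc (suc y))) (ZP.+-monoʳ-≤ (parts123 (suc y)) (Z.+≤+ (parts23-pos (suc (suc y)) (λ ()))))

  parts234 : Series
  parts234 = partsFrom2 3

  parts234-rec : ∀ n → parts234 n ≡ + parts23 n + shiftBy 4 parts234 n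
  parts234-rec n = trans (sym (lem (parts234 n) (shiftBy 4 parts234 n))) (cong (_+ shiftBy 4 parts234 n) (trans (mul-div-cancel 3 (partsFrom2 2) n) (sym (parts23-gen n))))
    where
    lem : ∀ a b → (a - b) + b ≡ a
    lem = solve-∀

  double-plus-3 : ∀ u → (3 N.+ u) N.+ (3 N.+ u) ≡ 6 N.+ (u N.+ u)
  double-plus-3 = NS.solve-∀

  parts23-even : ∀ t → parts23 (t N.+ t) ≡ parts13 t
  parts23-even 0 = refl
  parts23-even 1 = refl
  parts23-even 2 = refl
  parts23-even (suc (suc (suc t))) = trans (cong parts23 (double-plus-3 t)) (cong suc (parts23-even t))

  parts13-pred : ℕ → ℕ
  parts13-pred zero = 0
  parts13-pred (suc t) = parts13 t

  parts23-odd : ∀ t → parts23 (suc (t N.+ t)) ≡ parts13-pred t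
  parts23-odd 0 = refl
  parts23-odd 1 = refl
  parts23-odd 2 = refl
  parts23-odd 3 = refl
  parts23-odd (suc (suc (suc (suc t)))) = trans (cong (λ z → parts23 (suc z)) (double-plus-3 (suc t))) (cong suc (parts23-odd (suc t)))

  parts123-pred : ℕ → ℤ
  parts123-pred zero = + 0
  parts123-pred (suc t) = parts123 t

  double-plus-2 : ∀ u → (2 N.+ u) N.+ (2 N.+ u) ≡ 4 N.+ (u N.+ u)
  double-plus-2 = NS.solve-∀

  parts234-even : ∀ t → parts234 (t N.+ t) ≡ parts123 t
  parts234-even 0 = refl
  parts234-even 1 = refl
  parts234-even (suc (suc t)) = trans (cong parts234 (double-plus-2 t)) (trans (parts234-rec (4 N.+ (t N.+ t)))
     (trans (cong₂ _+_ (cong (λ z → + parts23 z) (sym (double-plus-2 t))) (parts234-even t))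
     (trans (cong (λ z → + z + parts123 t) (parts23-even (suc (suc t)))) (trans (ZP.+-comm _ (parts123 t)) (sym (parts123-suc-suc t))))))

  parts234-odd : ∀ t → parts234 (suc (t N.+ t)) ≡ parts123-pred t
  parts234-odd 0 = refl
  parts234-odd 1 = refl
  parts234-odd 2 = refl
  parts234-odd (suc (suc (suc t))) = trans (cong (λ z → parts234 (suc z)) (double-plus-2 (suc t))) (trans (parts234-rec (4 N.+ suc (suc t N.+ suc t)))
     (trans (cong₂ _+_ (cong (λ z → + parts23 (suc z)) (sym (double-plus-2 (suc t)))) (parts234-odd (suc t)))
     (trans (cong (λ z → + z + parts123 t) (parts23-odd (suc (suc (suc t))))) (trans (ZP.+-comm _ (parts123 t)) (sym (parts123-suc-suc t))))))

  -- Comparisons needed for k = 3, where the lower-half differences of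
  -- [3+s choose 3] are p_{23}(x) - p_{12}(x - s - 1) and x = s + 1 + a lies at
  -- offset 3a + 3 + δ:  p_{12}(a) ≤ p_{23}(3a + 3 + δ), with equality exactly in
  -- the exceptional residues of δ.
  offset : ℕ → ℕ → ℕ
  offset a δ = 3 N.* a N.+ 3 N.+ δ

  offset-suc-suc : ∀ a δ → offset (suc (suc a)) δ ≡ 6 N.+ offset a δ
  offset-suc-suc a δ = lemma a δ
    where
    lemma : ∀ a δ → 3 N.* suc (suc a) N.+ 3 N.+ δ ≡ 6 N.+ (3 N.* a N.+ 3 N.+ δ)
    lemma = NS.solve-∀

  double-suc : ∀ w → suc w N.+ suc w ≡ suc (suc (w N.+ w))
  double-suc w = cong suc (NP.+-suc w w)

  parts12≤parts23 : ∀ a δ → parts12 a N.≤ parts23 (offset a δ)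
  parts12≤parts23 0 δ = parts23-pos (offset 0 δ) (λ ())
  parts12≤parts23 1 δ = parts23-pos (offset 1 δ) (λ ())
  parts12≤parts23 (suc (suc a)) δ = subst (λ z → suc (parts12 a) N.≤ parts23 z) (sym (offset-suc-suc a δ)) (s≤s (parts12≤parts23 a δ))

  parts12<parts23-even : ∀ w δ → δ ≢ 0 → δ ≢ 1 → δ ≢ 2 → δ ≢ 4 → suc (parts12 (w N.+ w)) N.≤ parts23 (offset (w N.+ w) δ)
  parts12<parts23-even zero 0 h0 h1 h2 h4 = ⊥-elim (h0 refl)
  parts12<parts23-even zero 1 h0 h1 h2 h4 = ⊥-elim (h1 refl)
  parts12<parts23-even zero 2 h0 h1 h2 h4 = ⊥-elim (h2 refl)
  parts12<parts23-even zero 3 h0 h1 h2 h4 = s≤s (s≤s z≤n)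
  parts12<parts23-even zero 4 h0 h1 h2 h4 = ⊥-elim (h4 refl)
  parts12<parts23-even zero (suc (suc (suc (suc (suc d))))) h0 h1 h2 h4 = parts23-≥2 (8 N.+ d) (s≤s (s≤s (s≤s (s≤s (s≤s (s≤s z≤n)))))) (λ ())
  parts12<parts23-even (suc w) δ h0 h1 h2 h4 = subst (λ z → suc (parts12 z) N.≤ parts23 (offset z δ)) (sym (double-suc w))
     (subst (λ z → suc (suc (parts12 (w N.+ w))) N.≤ parts23 z) (sym (offset-suc-suc (w N.+ w) δ)) (s≤s (parts12<parts23-even w δ h0 h1 h2 h4)))

  parts12<parts23-odd : ∀ w δ → δ ≢ 1 → suc (parts12 (suc (w N.+ w))) N.≤ parts23 (offset (suc (w N.+ w)) δ)
  parts12<parts23-odd zero δ h1 = parts23-≥2 (6 N.+ δ) (s≤s (s≤s (s≤s (s≤s (s≤s (s≤s z≤n)))))) (λ e → h1 (cong (λ z → z ∸ 6) e))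
  parts12<parts23-odd (suc w) δ h1 = subst (λ z → suc (parts12 (suc z)) N.≤ parts23 (offset (suc z) δ)) (sym (double-suc w))
     (subst (λ z → suc (suc (parts12 (suc (w N.+ w)))) N.≤ parts23 z) (sym (offset-suc-suc (suc (w N.+ w)) δ)) (s≤s (parts12<parts23-odd w δ h1)))

  parts23-offset1 : ∀ a → parts23 (offset a 1) ≡ parts12 a
  parts23-offset1 0 = refl
  parts23-offset1 1 = refl
  parts23-offset1 (suc (suc a)) = trans (cong parts23 (offset-suc-suc a 1)) (cong suc (parts23-offset1 a))

  parts23-offset-even : ∀ δ → parts23 (offset 0 δ) ≡ 1 → ∀ w → parts23 (offset (w N.+ w) δ) ≡ parts12 (w N.+ w)
  parts23-offset-even δ h zero = h
  parts23-offset-even δ h (suc w) = trans (cong (λ z → parts23 (offset z δ)) (double-suc w)) (trans (cong parts23 (offset-suc-suc (w N.+ w) δ))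
     (trans (cong suc (parts23-offset-even δ h w)) (cong parts12 (sym (double-suc w)))))

  nonneg-≗ : ∀ {a b : Series} → a ≗ b → Nonnegative a → Nonnegative b
  nonneg-≗ h p n = subst (+ 0 Z.≤_) (h n) (p n)

  unimodal-≗ : ∀ {a b : Series} → a ≗ b → Unimodal a → Unimodal b
  unimodal-≗ h (j , p , q) = j , (λ i r → subst₂ Z._≤_ (h i) (h (suc i)) (p i r)) , (λ i r → subst₂ Z._≤_ (h (suc i)) (h i) (q i r))

  nonneg-unimodal-≗ : ∀ {a b : Series} → a ≗ b → Nonnegative a × Unimodal a → Nonnegative b × Unimodal b
  nonneg-unimodal-≗ h (p , q) = nonneg-≗ h p , unimodal-≗ h q

  constant-term-nonneg : ∀ e (A X : Series) → A 0 ≡ + 1 → X 0 ≡ + 1 → + 0 Z.≤ A 0 - shiftBy e X 0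
  constant-term-nonneg zero A X a x = sub-nonneg (ZP.≤-reflexive (trans x (sym a)))
  constant-term-nonneg (suc e) A X a x = sub-nonneg (subst (+ 0 Z.≤_) (sym a) (Z.+≤+ z≤n))

  Δ : Series → Series
  Δ g = mulOneMinus 1 g

  rising-step : ∀ g n → + 0 Z.≤ Δ g (suc n) → g n Z.≤ g (suc n)
  rising-step g n p = sub-nonneg⇒≤ p

  falling-step : ∀ g n → Δ g (suc n) Z.< + 0 → g (suc n) Z.< g n
  falling-step g n p = sub-neg⇒< p

  mirror-below : ∀ C D n → D N.≤ suc (C N.+ C) → C N.< n → D ∸ n N.≤ C
  mirror-below C D n D≤2C+1 C<n = NP.≤-trans (NP.∸-monoʳ-≤ D C<n)
    (NP.≤-trans (NP.∸-monoˡ-≤ (suc C) D≤2C+1) (NP.≤-reflexive (NP.m+n∸m≡n (suc C) C)))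

  palindromic-unimodal : ∀ (g : Series) (C D : ℕ) → D N.≤ suc (C N.+ C) → Palindromic g D → + 0 Z.≤ g 0 →
    (∀ n → suc n N.≤ C → g n Z.≤ g (suc n)) → Nonnegative g × Unimodal g
  palindromic-unimodal g C D D≤2C+1 (sy , zr) g0≥0 inc = nonneg , (C , (λ i i<C → inc i i<C) , dec)
    where
    low : ∀ n → n N.≤ C → + 0 Z.≤ g n
    low n n≤C = ZP.≤-trans g0≥0 (increasing-between g C inc 0 n z≤n n≤C)
    nonneg : Nonnegative g
    nonneg n with n N.≤? C | n N.≤? D
    ... | yes n≤C | _ = low n n≤C
    ... | no n≰C | yes n≤D = subst (+ 0 Z.≤_) (sym (sy n n≤D)) (low (D ∸ n) (mirror-below C D n D≤2C+1 (NP.≰⇒> n≰C)))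
    ... | no _ | no n≰D = ZP.≤-reflexive (sym (zr n (NP.≰⇒> n≰D)))
    -- Beyond the peak, a step i → i+1 is the mirror image of the step u → u+1
    -- with u = D - i - 1 ≤ C; at u = C the two points i, i+1 are mirror images.
    dec : ∀ i → C N.≤ i → g (suc i) Z.≤ g i
    dec i C≤i with suc i N.≤? D
    ... | no i+1≰D = subst (Z._≤ g i) (sym (zr (suc i) (NP.≰⇒> i+1≰D))) (nonneg i)
    ... | yes i+1≤D with suc (D ∸ suc i) N.≤? C
    ...   | yes u<C = subst₂ Z._≤_ (sym (sy (suc i) i+1≤D)) (trans (cong g (sym D∸i)) (sym (sy i (NP.≤-trans (NP.n≤1+n i) i+1≤D)))) (inc (D ∸ suc i) u<C)
      where
      D∸i : D ∸ i ≡ suc (D ∸ suc i)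
      D∸i = NP.+-∸-assoc 1 i+1≤D
    ...   | no u≮C = ZP.≤-reflexive (trans (sy (suc i) i+1≤D) (cong g (trans u≡C (sym i≡C))))
      where
      u≡C : D ∸ suc i ≡ C
      u≡C = NP.≤-antisym (mirror-below C D (suc i) D≤2C+1 (s≤s C≤i)) (NP.≤-pred (NP.≰⇒> u≮C))
      i≡D∸[u+1] : i ≡ D ∸ suc (D ∸ suc i)
      i≡D∸[u+1] = sym (trans (cong (D ∸_) (sym (NP.+-∸-assoc 1 i+1≤D))) (NP.m∸[m∸n]≡n (NP.≤-trans (NP.n≤1+n i) i+1≤D)))
      i≡C : i ≡ C
      i≡C = NP.≤-antisym (subst (N._≤ C) (sym i≡D∸[u+1]) (mirror-below C D (suc (D ∸ suc i)) D≤2C+1 (s≤s (NP.≤-reflexive (sym u≡C))))) C≤i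

  -- Obstruction: a strict descent g(e+1) < g(e) strictly before the middle
  -- (2e + 1 ≤ D) is followed by the mirrored ascent from D - e - 1 to D - e,
  -- so the series is not unimodal.
  palindromic-not-unimodal : ∀ (g : Series) (D e : ℕ) → Palindromic g D → suc (e N.+ e) N.≤ D → g (suc e) Z.< g e → ¬ Unimodal g
  palindromic-not-unimodal g D e (sy , zr) le lt (j , incr , decr) with j N.≤? e
  ... | yes p = ZP.<⇒≱ lt (subst (Z._≤ g (suc e)) gw
    (subst (λ z → g z Z.≤ g (suc e)) (NP.m+[n∸m]≡n se≤w) (decreasing-by g j decr (w ∸ suc e) (suc e) (NP.≤-trans p (NP.n≤1+n e)))))
    where
    e≤D : e N.≤ D
    e≤D = NP.≤-trans (NP.m≤m+n e e) (NP.≤-trans (NP.n≤1+n _) le)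
    w : ℕ
    w = D ∸ e
    gw : g w ≡ g e
    gw = trans (sy w (NP.m∸n≤m D e)) (cong g (NP.m∸[m∸n]≡n e≤D))
    se≤w : suc e N.≤ w
    se≤w = subst (N._≤ D ∸ e) (NP.m+n∸n≡m (suc e) e) (NP.∸-monoˡ-≤ e le)
  ... | no p = ZP.<⇒≱ lt (incr e (NP.≰⇒> p))

  Δ-sub : ∀ (A B : Series) n → Δ (λ j → A j - B j) n ≡ Δ A n - Δ B n
  Δ-sub A B n = trans (cong (λ z → A n - B n - z) (shift-sub 1 A B n)) (lem (A n) (B n) _ _)
    where
    lem : ∀ a b c d → a - b - (c - d) ≡ a - c - (b - d)
    lem = solve-∀

  Δ-shift : ∀ e (X : Series) n → Δ (shiftBy e X) n ≡ shiftBy e (Δ X) n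
  Δ-shift e X n = sym (trans (shift-sub e X (shiftBy 1 X) n) (cong (λ z → shiftBy e X n - z) (trans (shift-shift e 1 X n)
     (trans (cong (λ z → shiftBy z X n) (NP.+-comm e 1)) (sym (shift-shift 1 e X n))))))

  -- k = 2, m = 2 + s.  Then f = [2+s choose 2] - q^s, palindromic of degree 2s,
  -- and on the lower half Δf(x) = p_2(x) - [x = s].  For s even the only possible
  -- negative value at x = s vanishes; for s odd, Δf(s) = -1 is a descent.
  module CaseTwo (s : ℕ) where
    g : Series
    g n = gauss 2 s n - shiftBy s one n

    palindromic-g : Palindromic g (2 N.* s)
    palindromic-g = palindromic-sub (2 N.* s) (gauss-palindromic 2 s) (subst (Palindromic (shiftBy s one)) (l s) (palindromic-shift s one 0 palindromic-one))
      where
      l : ∀ s → s N.+ (s N.+ 0) ≡ 2 N.* s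
      l = NS.solve-∀

    Δg : ∀ x → x N.≤ s → Δ g x ≡ + parts2 x - shiftBy s (Δ one) x
    Δg x p = trans (Δ-sub (gauss 2 s) (shiftBy s one) x) (cong₂ _-_ (trans (difference-gauss-low 1 s x (NP.≤-trans p (NP.≤-trans (NP.m≤m+n s s) (NP.n≤1+n _))))
        (trans (cong (λ z → partsFrom2 1 x - z) (shift-< (suc s) (divProd 1 one) x (s≤s p))) (trans (ZP.+-identityʳ _) (sym (parts2-gen x)))))
        (Δ-shift s one x))

    shΔ-lt : ∀ x → x N.< s → shiftBy s (Δ one) x ≡ + 0
    shΔ-lt x p = shift-< s (Δ one) x p

    shΔ-eq : shiftBy s (Δ one) s ≡ + 1
    shΔ-eq = trans (shift-≥ s (Δ one) s NP.≤-refl) (cong (Δ one) (NP.n∸n≡0 s))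

    constant-term : + 0 Z.≤ g 0
    constant-term = constant-term-nonneg s (gauss 2 s) one (gauss-at-zero 2 s) refl

    nonneg-unimodal : ∀ u → s ≡ u N.+ u → Nonnegative g × Unimodal g
    nonneg-unimodal u su = palindromic-unimodal g s (2 N.* s) (NP.≤-trans (NP.≤-reflexive (sym (l s))) (NP.n≤1+n _)) palindromic-g constant-term
        (λ n p → rising-step g n (Δ≥0 (suc n) p))
      where
      l : ∀ s → s N.+ s ≡ 2 N.* s
      l = NS.solve-∀
      Δ≥0 : ∀ x → x N.≤ s → + 0 Z.≤ Δ g x
      Δ≥0 x p with x N.≟ s
      ... | yes refl = subst (+ 0 Z.≤_) (sym (Δg x p)) (subst (λ z → + 0 Z.≤ + parts2 x - z) (sym shΔ-eq)
            (subst (λ z → + 0 Z.≤ + parts2 z - + 1) (sym su) (subst (λ z → + 0 Z.≤ + z - + 1) (sym (parts2-even u)) (Z.+≤+ z≤n))))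
      ... | no q = subst (+ 0 Z.≤_) (sym (Δg x p)) (subst (λ z → + 0 Z.≤ + parts2 x - z) (sym (shΔ-lt x (NP.≤∧≢⇒< p q)))
            (subst (+ 0 Z.≤_) (sym (ZP.+-identityʳ _)) (Z.+≤+ z≤n)))

    not-unimodal : ∀ u → s ≡ suc (u N.+ u) → ¬ Unimodal g
    not-unimodal u su = palindromic-not-unimodal g (2 N.* s) (u N.+ u) palindromic-g le1 (falling-step g (u N.+ u) Δ<0)
      where
      l : ∀ u → 2 N.* suc (u N.+ u) ≡ suc ((u N.+ u) N.+ (u N.+ u)) N.+ 1
      l = NS.solve-∀
      le1 : suc ((u N.+ u) N.+ (u N.+ u)) N.≤ 2 N.* s
      le1 = subst (λ z → suc ((u N.+ u) N.+ (u N.+ u)) N.≤ 2 N.* z) (sym su) (subst (suc ((u N.+ u) N.+ (u N.+ u)) N.≤_) (sym (l u)) (NP.m≤m+n _ 1))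
      Δ<0 : Δ g (suc (u N.+ u)) Z.< + 0
      Δ<0 = subst (Z._< + 0) (sym (trans (Δg (suc (u N.+ u)) (NP.≤-reflexive (sym su)))
               (cong₂ _-_ (cong +_ (parts2-odd u)) (subst (λ z → shiftBy s (Δ one) z ≡ + 1) su shΔ-eq)))) Z.-<+

  -- For k = 2 the exponent is s = m - 2 and [b choose 0] = 1, whatever b is.
  f2-reduction : ∀ s b → f 2 (2 N.+ s) b ≗ CaseTwo.g s
  f2-reduction s b n = cong (_-_ (gauss 2 s n)) (trans (cong (λ z → shiftBy z (qbinom b 0) n) expo≡s) (shift-cong s (divProd-mulProd-cancel b one) n))
    where
    double : ∀ s → 2 N.* (2 N.+ s) ≡ (2 N.+ s) N.+ (2 N.+ s)
    double = NS.solve-∀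
    expo≡s : expo 2 (2 N.+ s) b ≡ s
    expo≡s = cong (_∸ 2) (trans (cong (N._/ 2) (double s)) (double/2 (2 N.+ s)))

  theorem-k2 : (m b : ℕ) → Admissible 2 m b → ((Nonnegative (f 2 m b) × Unimodal (f 2 m b)) ⇔ (2 ∣ m))
  theorem-k2 0 b (_ , () , _)
  theorem-k2 1 b (_ , s≤s () , _)
  theorem-k2 (suc (suc s)) b _ with parity s
  ... | u , inj₁ s≡2u = mk⇔
    (λ _ → 2∣2+double u s≡2u)
    (λ _ → nonneg-unimodal-≗ (≗-sym (f2-reduction s b)) (CaseTwo.nonneg-unimodal s u s≡2u))
  ... | u , inj₂ s≡2u+1 = mk⇔
    (λ nu → ⊥-elim (CaseTwo.not-unimodal s u s≡2u+1 (unimodal-≗ (f2-reduction s b) (proj₂ nu))))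
    (λ 2∣m → ⊥-elim (2∤2+odd u s≡2u+1 2∣m))

  -- k = 4, m = 4 + s, b = 2 + s' with s' ≤ 2s, e = 2s - s'.  Then
  -- f = [4+s choose 4] - q^e [2+s' choose 2] is palindromic of degree 4s and for
  -- x ≤ 2s its first difference is A(x) - p_2(x - e), where
  -- A(x) = p_{234}(x) - p_{123}(x - s - 1).
  module CaseFour (s s' : ℕ) (le : s' N.≤ s N.+ s) where
    e : ℕ
    e = (s N.+ s) ∸ s'
    es : e N.+ s' ≡ s N.+ s
    es = NP.m∸n+n≡m le
    g : Series
    g n = gauss 4 s n - shiftBy e (gauss 2 s') n

    palindromic-g : Palindromic g (4 N.* s)
    palindromic-g = palindromic-sub (4 N.* s) (gauss-palindromic 4 s) (subst (Palindromic (shiftBy e (gauss 2 s'))) eqD (palindromic-shift e (gauss 2 s') (2 N.* s') (gauss-palindromic 2 s')))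
      where
      l1 : ∀ e s' → e N.+ (e N.+ 2 N.* s') ≡ (e N.+ s') N.+ (e N.+ s')
      l1 = NS.solve-∀
      l2 : ∀ s → (s N.+ s) N.+ (s N.+ s) ≡ 4 N.* s
      l2 = NS.solve-∀
      eqD : e N.+ (e N.+ 2 N.* s') ≡ 4 N.* s
      eqD = trans (l1 e s') (trans (cong₂ N._+_ es es) (l2 s))

    A : ℕ → ℤ
    A x = parts234 x - shiftBy (suc s) parts123 x

    Δg : ∀ x → x N.≤ s N.+ s → Δ g x ≡ A x - shiftBy e (natSeries parts2) x
    Δg x p = trans (Δ-sub (gauss 4 s) (shiftBy e (gauss 2 s')) x) (cong₂ _-_ (difference-gauss-low 3 s x (NP.≤-trans p (NP.n≤1+n _)))
        (trans (Δ-shift e (gauss 2 s') x) (shift-agree e (Δ (gauss 2 s')) (natSeries parts2) x q)))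
      where
      q : e N.≤ x → Δ (gauss 2 s') (x ∸ e) ≡ + parts2 (x ∸ e)
      q r = trans (difference-gauss-low 1 s' (x ∸ e) (NP.≤-trans xe (NP.≤-trans (NP.m≤m+n s' s') (NP.n≤1+n _))))
            (trans (cong (λ z → partsFrom2 1 (x ∸ e) - z) (shift-< (suc s') (divProd 1 one) (x ∸ e) (s≤s xe)))
            (trans (ZP.+-identityʳ _) (sym (parts2-gen (x ∸ e)))))
        where
        xe : x ∸ e N.≤ s'
        xe = subst (x ∸ e N.≤_) (NP.m+n∸m≡n e s') (NP.∸-monoˡ-≤ e (subst (x N.≤_) (sym es) p))

    E≤1 : ∀ x → shiftBy e (natSeries parts2) x Z.≤ + 1
    E≤1 x with e N.≤? x
    ... | yes p = subst (Z._≤ + 1) (sym (shift-≥ e (natSeries parts2) x p)) (Z.+≤+ (parts2≤1 (x ∸ e)))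
    ... | no p = subst (Z._≤ + 1) (sym (shift-< e (natSeries parts2) x (NP.≰⇒> p))) (Z.+≤+ z≤n)

    E-odd : ∀ w t → e ≡ w N.+ w → shiftBy e (natSeries parts2) (suc (t N.+ t)) ≡ + 0
    E-odd w t ew with e N.≤? suc (t N.+ t)
    ... | no p = shift-< e (natSeries parts2) _ (NP.≰⇒> p)
    ... | yes p = trans (shift-≥ e (natSeries parts2) _ p) (cong +_ (trans (cong parts2 xe) (parts2-odd (t ∸ w))))
      where
      wt : w N.≤ t
      wt = NP.≤-pred (double-cancel-< w (suc t) (subst (N._≤ suc t N.+ suc t) (cong suc ew) (NP.≤-trans (s≤s p) (NP.≤-reflexive (cong suc (sym (NP.+-suc t t)))))))
      xe : suc (t N.+ t) ∸ e ≡ suc ((t ∸ w) N.+ (t ∸ w))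
      xe = trans (cong (suc (t N.+ t) ∸_) ew) (∸-of-+ (w N.+ w) (trans (cong (λ z → suc (z N.+ z)) (sym (NP.m+[n∸m]≡n wt))) (l (t ∸ w) w)))
        where
        l : ∀ a w → suc ((w N.+ a) N.+ (w N.+ a)) ≡ (w N.+ w) N.+ suc (a N.+ a)
        l = NS.solve-∀

    -- A(2t) ≥ 1 for 1 ≤ t ≤ s when s ≠ 1, using p_{234}(2t) = p_{123}(t).
    A-even : ∀ t → 1 N.≤ t → t N.≤ s → s ≢ 1 → + 1 Z.≤ A (t N.+ t)
    A-even t t1 ts s1 rewrite parts234-even t with suc s N.≤? t N.+ t
    ... | no p = subst (λ z → + 1 Z.≤ parts123 t - z) (sym (shift-< (suc s) parts123 _ (NP.≰⇒> p))) (subst (+ 1 Z.≤_) (sym (ZP.+-identityʳ (parts123 t))) (parts123-pos t))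
    ... | yes p = subst (λ z → + 1 Z.≤ parts123 t - z) (sym (shift-≥ (suc s) parts123 _ p)) (main t t1 ts p)
      where
      main : ∀ t → 1 N.≤ t → t N.≤ s → suc s N.≤ t N.+ t → + 1 Z.≤ parts123 t - parts123 (t N.+ t ∸ suc s)
      main (suc zero) _ ts p = ⊥-elim (s1 (NP.≤-antisym (NP.≤-pred p) ts))
      main (suc (suc y)) _ ts p = one≤sub (parts123-mono ((suc (suc y) N.+ suc (suc y)) ∸ suc s) (suc y) bd) (parts123-strict y)
        where
        bd : (suc (suc y) N.+ suc (suc y)) ∸ suc s N.≤ suc y
        bd = NP.≤-trans (NP.∸-monoʳ-≤ (suc (suc y) N.+ suc (suc y)) (s≤s ts)) (NP.≤-reflexive (∸-of-+ (suc (suc (suc y))) (l y)))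
          where
          l : ∀ y → suc (suc y) N.+ suc (suc y) ≡ suc (suc (suc y)) N.+ suc y
          l = NS.solve-∀

    -- A(2t+1) ≥ 0 in the lower half, using p_{234}(2t+1) = p_{123}(t-1).
    A-odd : ∀ t → suc (t N.+ t) N.≤ s N.+ s → + 0 Z.≤ A (suc (t N.+ t))
    A-odd t p rewrite parts234-odd t with suc s N.≤? suc (t N.+ t)
    ... | no q = subst (λ z → + 0 Z.≤ parts123-pred t - z) (sym (shift-< (suc s) parts123 _ (NP.≰⇒> q))) (subst (+ 0 Z.≤_) (sym (ZP.+-identityʳ (parts123-pred t))) (po t))
      where
      po : ∀ t → + 0 Z.≤ parts123-pred t
      po zero = Z.+≤+ z≤n
      po (suc t) = ZP.≤-trans (Z.+≤+ z≤n) (parts123-pos t)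
    ... | yes q = subst (λ z → + 0 Z.≤ parts123-pred t - z) (sym (shift-≥ (suc s) parts123 _ q)) (main t (double-cancel-< t s p) q)
      where
      main : ∀ t → suc t N.≤ s → suc s N.≤ suc (t N.+ t) → + 0 Z.≤ parts123-pred t - parts123 (suc (t N.+ t) ∸ suc s)
      main zero ts q = ⊥-elim (NP.<⇒≱ ts (NP.≤-pred q))
      main (suc y) ts q = sub-nonneg (parts123-mono (suc (suc y N.+ suc y) ∸ suc s) y (NP.≤-trans (NP.∸-monoʳ-≤ (suc y N.+ suc y) ts) (NP.≤-reflexive (∸-of-+ (suc (suc y)) (l y)))))
        where
        l : ∀ y → suc y N.+ suc y ≡ suc (suc y) N.+ y
        l = NS.solve-∀

    A-zero : ∀ t → s ≡ suc t → A (suc (t N.+ t)) ≡ + 0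
    A-zero zero refl = refl
    A-zero (suc y) refl rewrite parts234-odd (suc y) =
      trans (cong (λ z → parts123 y - z) (trans (shift-≥ (suc (suc (suc y))) parts123 _ le') (cong parts123 (∸-of-+ (suc (suc y)) (l y)))))
            (ZP.+-inverseʳ (parts123 y))
      where
      l : ∀ y → suc y N.+ suc y ≡ suc (suc y) N.+ y
      l = NS.solve-∀
      le' : suc (suc (suc y)) N.≤ suc (suc y N.+ suc y)
      le' = s≤s (s≤s (NP.m≤n+m (suc y) y))

    constant-term : + 0 Z.≤ g 0
    constant-term = constant-term-nonneg e (gauss 4 s) (gauss 2 s') (gauss-at-zero 4 s) (gauss-at-zero 2 s')

    nonneg-unimodal : ∀ u → s' ≡ u N.+ u → s ≢ 1 → Nonnegative g × Unimodal g
    nonneg-unimodal u su s1 = palindromic-unimodal g (s N.+ s) (4 N.* s) (NP.≤-trans (NP.≤-reflexive (sym (l1 s))) (NP.n≤1+n _)) palindromic-g constant-term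
        (λ n p → rising-step g n (Δ≥0 (suc n) (s≤s z≤n) p))
      where
      l1 : ∀ s → (s N.+ s) N.+ (s N.+ s) ≡ 4 N.* s
      l1 = NS.solve-∀
      u≤s : u N.≤ s
      u≤s with u N.≤? s
      ... | yes p = p
      ... | no p = ⊥-elim (NP.<⇒≱ (NP.+-mono-< (NP.≰⇒> p) (NP.≰⇒> p)) (subst (N._≤ s N.+ s) su le))
      w : ℕ
      w = s ∸ u
      ew : e ≡ w N.+ w
      ew = trans (cong (λ z → (z N.+ z) ∸ s') (sym (NP.m+[n∸m]≡n u≤s))) (trans (cong (λ z → ((u N.+ w) N.+ (u N.+ w)) ∸ z) su) (∸-of-+ (u N.+ u) (l2 u w)))
        where
        l2 : ∀ u w → (u N.+ w) N.+ (u N.+ w) ≡ (u N.+ u) N.+ (w N.+ w)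
        l2 = NS.solve-∀
      Δ≥0 : ∀ x → 1 N.≤ x → x N.≤ s N.+ s → + 0 Z.≤ Δ g x
      Δ≥0 x x1 p with parity x
      ... | t , inj₁ xt = subst (+ 0 Z.≤_) (sym (Δg x p)) (subst (λ z → + 0 Z.≤ A z - shiftBy e (natSeries parts2) z) (sym xt) (sub-nonneg-of-bounds (A-even t t1 ts s1) (E≤1 (t N.+ t))))
        where
        t1 : 1 N.≤ t
        t1 with 1 N.≤? t
        ... | yes q = q
        ... | no q = ⊥-elim (NP.<⇒≱ x1 (NP.≤-reflexive (trans xt (cong (λ z → z N.+ z) (NP.n<1⇒n≡0 (NP.≰⇒> q))))))
        ts : t N.≤ s
        ts with t N.≤? s
        ... | yes q = q
        ... | no q = ⊥-elim (NP.<⇒≱ (NP.+-mono-< (NP.≰⇒> q) (NP.≰⇒> q)) (subst (N._≤ s N.+ s) xt p))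
      ... | t , inj₂ xt = subst (+ 0 Z.≤_) (sym (Δg x p)) (subst (λ z → + 0 Z.≤ A z - shiftBy e (natSeries parts2) z) (sym xt)
            (subst (λ z → + 0 Z.≤ A (suc (t N.+ t)) - z) (sym (E-odd w t ew)) (subst (+ 0 Z.≤_) (sym (ZP.+-identityʳ _)) (A-odd t (subst (N._≤ s N.+ s) xt p)))))

    -- s' odd and s = t + 1: at x = 2t + 1 we have A(x) = 0 and p_2(x - e) = 1, a descent.
    not-unimodal : ∀ u t → s ≡ suc t → s' ≡ suc (u N.+ u) → ¬ Unimodal g
    not-unimodal u t st su = palindromic-not-unimodal g (4 N.* s) (t N.+ t) palindromic-g le1 (falling-step g (t N.+ t) Δ<0)
      where
      l3 : ∀ t → 4 N.* suc t ≡ suc ((t N.+ t) N.+ (t N.+ t)) N.+ 3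
      l3 = NS.solve-∀
      le1 : suc ((t N.+ t) N.+ (t N.+ t)) N.≤ 4 N.* s
      le1 = subst (λ z → suc ((t N.+ t) N.+ (t N.+ t)) N.≤ 4 N.* z) (sym st) (subst (suc ((t N.+ t) N.+ (t N.+ t)) N.≤_) (sym (l3 t)) (NP.m≤m+n _ 3))
      x : ℕ
      x = suc (t N.+ t)
      px : x N.≤ s N.+ s
      px = subst (λ z → x N.≤ z N.+ z) (sym st) (s≤s (NP.+-monoʳ-≤ t (NP.n≤1+n t)))
      l4 : ∀ e u t → e N.+ suc (u N.+ u) ≡ suc t N.+ suc t → suc (e N.+ (u N.+ u)) ≡ suc (suc (t N.+ t))
      l4 e u t h = trans (sym (NP.+-suc e (u N.+ u))) (trans h (cong suc (NP.+-suc t t)))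
      ex : x ≡ e N.+ (u N.+ u)
      ex = sym (NP.suc-injective (l4 e u t (trans (cong (e N.+_) (sym su)) (trans es (cong (λ z → z N.+ z) st)))))
      E1 : shiftBy e (natSeries parts2) x ≡ + 1
      E1 = trans (shift-≥ e (natSeries parts2) x (subst (e N.≤_) (sym ex) (NP.m≤m+n e _))) (cong +_ (trans (cong parts2 (∸-of-+ e ex)) (parts2-even u)))
      Δ<0 : Δ g (suc (t N.+ t)) Z.< + 0
      Δ<0 = subst (Z._< + 0) (sym (trans (Δg x px) (cong₂ _-_ (A-zero t st) E1))) (Z.-<+)

    -- s' odd forces s ≥ 1, so the previous lemma applies.
    not-unimodal-odd : ∀ u → s' ≡ suc (u N.+ u) → ¬ Unimodal g
    not-unimodal-odd u s'≡2u+1 = not-unimodal u (s ∸ 1) (sym (NP.m+[n∸m]≡n 1≤s)) s'≡2u+1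
      where
      1≤s : 1 N.≤ s
      1≤s = NP.n≢0⇒n>0 (λ s≡0 → NP.<⇒≱ (s≤s z≤n) (subst₂ N._≤_ s'≡2u+1 (cong (λ z → z N.+ z) s≡0) le))

  -- m = 5 (s = 1): the only admissible even b are 2 and 4, where f equals
  -- 1 + q + q³ + q⁴ (not unimodal) and -q² (negative).
  m≡5-b≡2-not-unimodal : ∀ le → ¬ Unimodal (CaseFour.g 1 0 le)
  m≡5-b≡2-not-unimodal le = palindromic-not-unimodal (CaseFour.g 1 0 le) 4 1 (CaseFour.palindromic-g 1 0 le) (s≤s (s≤s (s≤s z≤n))) (Z.+<+ (s≤s z≤n))

  m≡5-b≡4-negative : ∀ le → ¬ Nonnegative (CaseFour.g 1 2 le)
  m≡5-b≡4-negative le nn = -1-negative (nn 2)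

  m≡5-fails : ∀ s s' le u → s' ≡ u N.+ u → s ≡ 1 → f 4 (4 N.+ s) (2 N.+ s') ≗ CaseFour.g s s' le →
        ¬ (Nonnegative (f 4 (4 N.+ s) (2 N.+ s')) × Unimodal (f 4 (4 N.+ s) (2 N.+ s')))
  m≡5-fails .1 .0 le zero refl refl fg nu = m≡5-b≡2-not-unimodal le (unimodal-≗ fg (proj₂ nu))
  m≡5-fails .1 .2 le (suc zero) refl refl fg nu = m≡5-b≡4-negative le (nonneg-≗ fg (proj₁ nu))
  m≡5-fails .1 .(suc (suc u) N.+ suc (suc u)) le (suc (suc u)) refl refl fg nu = NP.<⇒≱ (s≤s (s≤s (NP.≤-trans (s≤s z≤n) (NP.m≤n+m (suc (suc u)) u)))) le

  -- Translating Admissible 4 m b: s' ≤ 2s and the exponent of f(4, 4+s, 2+s')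
  -- is e = 2s - s', so f is CaseFour.g.
  module ReductionFour (s s' : ℕ) (bnd : 2 N.* (2 N.+ s') N.≤ 4 N.* (4 N.+ s) N.+ 4 ∸ 16) where
    le : s' N.≤ s N.+ s
    le = double-cancel-≤ s' (s N.+ s) (NP.+-cancelˡ-≤ 4 _ _ (subst₂ N._≤_ (l1 s') (∸-of-+ 16 (l2 s)) bnd))
      where
      l1 : ∀ s' → 2 N.* (2 N.+ s') ≡ 4 N.+ (s' N.+ s')
      l1 = NS.solve-∀
      l2 : ∀ s → 4 N.* (4 N.+ s) N.+ 4 ≡ 16 N.+ (4 N.+ ((s N.+ s) N.+ (s N.+ s)))
      l2 = NS.solve-∀
    e : ℕ
    e = CaseFour.e s s' le
    ex : expo 4 (4 N.+ s) (2 N.+ s') ≡ e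
    ex = trans (cong (λ z → z N./ 2 ∸ 6) (∸-of-+ (2 N.* (2 N.+ s')) eq)) (trans (cong (_∸ 6) (double/2 (6 N.+ e))) (NP.m+n∸m≡n 6 e))
      where
      l3 : ∀ s s' e → 2 N.* (2 N.+ s') N.+ ((6 N.+ e) N.+ (6 N.+ e)) ≡ 16 N.+ ((e N.+ s') N.+ (e N.+ s'))
      l3 = NS.solve-∀
      l4 : ∀ s → 16 N.+ ((s N.+ s) N.+ (s N.+ s)) ≡ 4 N.* (4 N.+ s)
      l4 = NS.solve-∀
      eq : 4 N.* (4 N.+ s) ≡ 2 N.* (2 N.+ s') N.+ ((6 N.+ e) N.+ (6 N.+ e))
      eq = sym (trans (l3 s s' e) (trans (cong (λ z → 16 N.+ (z N.+ z)) (CaseFour.es s s' le)) (l4 s)))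
    fg : f 4 (4 N.+ s) (2 N.+ s') ≗ CaseFour.g s s' le
    fg n = cong (λ z → gauss 4 s n - shiftBy z (gauss 2 s') n) ex

    equivalence : (Nonnegative (f 4 (4 N.+ s) (2 N.+ s')) × Unimodal (f 4 (4 N.+ s) (2 N.+ s'))) ⇔ ((2 ∣ 2 N.+ s') × (4 N.+ s ≢ 5))
    equivalence with parity s'
    ... | u , inj₁ s'≡2u = mk⇔
      (λ nu → 2∣2+double u s'≡2u , λ m≡5 → m≡5-fails s s' le u s'≡2u (NP.+-cancelˡ-≡ 4 s 1 m≡5) fg nu)
      (λ { (_ , m≢5) → nonneg-unimodal-≗ (≗-sym fg) (CaseFour.nonneg-unimodal s s' le u s'≡2u (λ s≡1 → m≢5 (cong (4 N.+_) s≡1))) })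
    ... | u , inj₂ s'≡2u+1 = mk⇔
      (λ nu → ⊥-elim (CaseFour.not-unimodal-odd s s' le u s'≡2u+1 (unimodal-≗ fg (proj₂ nu))))
      (λ { (2∣b , _) → ⊥-elim (2∤2+odd u s'≡2u+1 2∣b) })

  theorem-k4 : (m b : ℕ) → Admissible 4 m b → ((Nonnegative (f 4 m b) × Unimodal (f 4 m b)) ⇔ ((2 ∣ b) × (m ≢ 5)))
  theorem-k4 0 b (_ , () , _)
  theorem-k4 1 b (_ , s≤s () , _)
  theorem-k4 2 b (_ , s≤s (s≤s ()) , _)
  theorem-k4 3 b (_ , s≤s (s≤s (s≤s ())) , _)
  theorem-k4 (suc (suc (suc (suc s)))) 0 (_ , _ , () , _)
  theorem-k4 (suc (suc (suc (suc s)))) 1 (_ , _ , s≤s () , _)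
  theorem-k4 (suc (suc (suc (suc s)))) (suc (suc s')) (_ , _ , _ , bnd , _) =
    ReductionFour.equivalence s s' (bnd (s≤s (s≤s (s≤s z≤n))))

  -- k = 3, m = 3 + s, b = 1 + s' with 2e + s' = 3s.  Then
  -- f = [3+s choose 3] - q^e [1+s' choose 1] is palindromic of degree 3s and for
  -- 2x ≤ 3s its first difference is B(x) - [x = e], where
  -- B(x) = p_{23}(x) - p_{12}(x - s - 1) ≥ 0.  So f is nonnegative and unimodal
  -- iff B(e) ≥ 1, and B(e) = 0 produces a descent.
  module CaseThree (s s' e : ℕ) (h : e N.+ e N.+ s' ≡ s N.+ s N.+ s) where
    g : Series
    g n = gauss 3 s n - shiftBy e (gauss 1 s') n

    palindromic-g : Palindromic g (3 N.* s)
    palindromic-g = palindromic-sub (3 N.* s) (gauss-palindromic 3 s) (subst (Palindromic (shiftBy e (gauss 1 s'))) eqD (palindromic-shift e (gauss 1 s') (1 N.* s') (gauss-palindromic 1 s')))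
      where
      l1 : ∀ e s' → e N.+ (e N.+ 1 N.* s') ≡ e N.+ e N.+ s'
      l1 = NS.solve-∀
      l2 : ∀ s → s N.+ s N.+ s ≡ 3 N.* s
      l2 = NS.solve-∀
      eqD : e N.+ (e N.+ 1 N.* s') ≡ 3 N.* s
      eqD = trans (l1 e s') (trans h (l2 s))

    B : ℕ → ℤ
    B x = + parts23 x - shiftBy (suc s) (natSeries parts12) x

    hx1 : ∀ x → x N.+ x N.≤ s N.+ s N.+ s → x N.≤ suc (s N.+ s)
    hx1 x p with x N.≤? suc (s N.+ s)
    ... | yes q = q
    ... | no q = ⊥-elim (NP.<⇒≱ (NP.≤-trans (subst (suc (s N.+ s N.+ s) N.≤_) (sym (l s)) (NP.m≤m+n _ (s N.+ 3))) (NP.+-mono-≤ (NP.≰⇒> q) (NP.≰⇒> q))) p)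
      where
      l : ∀ s → suc (suc (s N.+ s)) N.+ suc (suc (s N.+ s)) ≡ suc (s N.+ s N.+ s) N.+ (s N.+ 3)
      l = NS.solve-∀

    hx2 : ∀ x → x N.+ x N.≤ s N.+ s N.+ s → x ∸ e N.≤ s'
    hx2 x p with x ∸ e N.≤? s'
    ... | yes q = q
    ... | no q = ⊥-elim (NP.<⇒≱ (NP.≤-<-trans (NP.≤-trans (NP.m≤m+n (e N.+ e N.+ s') s') (NP.≤-reflexive (l e s'))) (NP.+-mono-< lt lt)) (subst (x N.+ x N.≤_) (sym h) p))
      where
      ex : e N.≤ x
      ex with e N.≤? x
      ... | yes r = r
      ... | no r = ⊥-elim (q (subst (N._≤ s') (sym (NP.m≤n⇒m∸n≡0 (NP.<⇒≤ (NP.≰⇒> r)))) z≤n))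
      lt : e N.+ s' N.< x
      lt = subst (e N.+ s' N.<_) (NP.m+[n∸m]≡n ex) (NP.+-monoʳ-< e (NP.≰⇒> q))
      l : ∀ e s' → e N.+ e N.+ s' N.+ s' ≡ (e N.+ s') N.+ (e N.+ s')
      l = NS.solve-∀

    Δg : ∀ x → x N.+ x N.≤ s N.+ s N.+ s → Δ g x ≡ B x - shiftBy e one x
    Δg x p = trans (Δ-sub (gauss 3 s) (shiftBy e (gauss 1 s')) x) (cong₂ _-_
        (trans (difference-gauss-low 2 s x (hx1 x p)) (cong₂ _-_ (sym (parts23-gen x)) (shift-cong (suc s) (≗-sym parts12-gen) x)))
        (trans (Δ-shift e (gauss 1 s') x) (shift-agree e (Δ (gauss 1 s')) one x q)))
      where
      q : e N.≤ x → Δ (gauss 1 s') (x ∸ e) ≡ one (x ∸ e)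
      q r = trans (difference-gauss-low 0 s' (x ∸ e) (NP.≤-trans (hx2 x p) (NP.≤-trans (NP.m≤m+n s' s') (NP.n≤1+n _))))
            (trans (cong (λ z → one (x ∸ e) - z) (shift-< (suc s') (divProd 0 one) (x ∸ e) (s≤s (hx2 x p)))) (ZP.+-identityʳ _))

    sh1-eq : shiftBy e one e ≡ + 1
    sh1-eq = trans (shift-≥ e one e NP.≤-refl) (cong one (NP.n∸n≡0 e))

    sh1-neq : ∀ x → x ≢ e → shiftBy e one x ≡ + 0
    sh1-neq x ne with e N.≤? x
    ... | no r = shift-< e one x (NP.≰⇒> r)
    ... | yes r = trans (shift-≥ e one x r) (one-above-zero (x ∸ e) (λ z → ne (NP.≤-antisym (NP.m∸n≡0⇒m≤n z) r)))

    -- Above degree s, B(x) = p_{23}(x) - p_{12}(x - s - 1); such x lies at offset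
    -- 3a + 3 + δ with a = x - s - 1, so B is nonnegative on the lower half.
    Bform : ∀ x → suc s N.≤ x → B x ≡ + parts23 x - + parts12 (x ∸ suc s)
    Bform x p = cong (λ z → + parts23 x - z) (shift-≥ (suc s) (natSeries parts12) x p)

    locate : ∀ x → suc s N.≤ x → x N.+ x N.≤ s N.+ s N.+ s → 3 N.* (x ∸ suc s) N.+ 3 N.≤ x
    locate x p q = NP.+-cancelˡ-≤ (x N.+ x) _ x (subst (x N.+ x N.+ (3 N.* a N.+ 3) N.≤_) (eq2) (NP.+-monoˡ-≤ (3 N.* a N.+ 3) q))
      where
      a : ℕ
      a = x ∸ suc s
      xa : x ≡ suc s N.+ a
      xa = sym (NP.m+[n∸m]≡n p)
      l : ∀ s a → s N.+ s N.+ s N.+ (3 N.* a N.+ 3) ≡ (suc s N.+ a) N.+ (suc s N.+ a) N.+ (suc s N.+ a)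
      l = NS.solve-∀
      eq2 : s N.+ s N.+ s N.+ (3 N.* a N.+ 3) ≡ x N.+ x N.+ x
      eq2 = trans (l s a) (cong (λ z → z N.+ z N.+ z) (sym xa))

    B-nonneg : ∀ x → x N.+ x N.≤ s N.+ s N.+ s → + 0 Z.≤ B x
    B-nonneg x p with suc s N.≤? x
    ... | no q = subst (+ 0 Z.≤_) (sym (trans (cong (λ z → + parts23 x - z) (shift-< (suc s) (natSeries parts12) x (NP.≰⇒> q))) (ZP.+-identityʳ _))) (Z.+≤+ z≤n)
    ... | yes q = subst (+ 0 Z.≤_) (sym (Bform x q))
      (sub-nonneg (Z.+≤+ (subst (λ z → parts12 a N.≤ parts23 z) (NP.m+[n∸m]≡n (locate x q p)) (parts12≤parts23 a (x ∸ (3 N.* a N.+ 3))))))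
      where
      a : ℕ
      a = x ∸ suc s

    ee3 : e N.+ e N.≤ s N.+ s N.+ s
    ee3 = subst (e N.+ e N.≤_) h (NP.m≤m+n _ s')

    epos : suc s N.≤ e → (e ≡ offset (e ∸ suc s) s') × (s ≡ (e ∸ suc s) N.+ (e ∸ suc s) N.+ 2 N.+ s')
    epos p = ex , sx
      where
      a : ℕ
      a = e ∸ suc s
      xa : e ≡ suc s N.+ a
      xa = sym (NP.m+[n∸m]≡n p)
      l : ∀ s a → s N.+ s N.+ s N.+ (3 N.* a N.+ 3) ≡ (suc s N.+ a) N.+ (suc s N.+ a) N.+ (suc s N.+ a)
      l = NS.solve-∀
      eq1 : e N.+ e N.+ (s' N.+ (3 N.* a N.+ 3)) ≡ e N.+ e N.+ e
      eq1 = trans (sym (NP.+-assoc (e N.+ e) s' _)) (trans (cong (N._+ (3 N.* a N.+ 3)) h) (trans (l s a) (cong (λ z → z N.+ z N.+ z) (sym xa))))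
      ex : e ≡ offset a s'
      ex = sym (trans (NP.+-comm (3 N.* a N.+ 3) s') (NP.+-cancelˡ-≡ (e N.+ e) _ _ eq1))
      l2 : ∀ s a s' → suc s N.+ a ≡ 3 N.* a N.+ 3 N.+ s' → s ≡ a N.+ a N.+ 2 N.+ s'
      l2 s a s' q = NP.+-cancelʳ-≡ (suc a) s (a N.+ a N.+ 2 N.+ s') (trans (l3 s a) (trans q (l4 a s')))
        where
        l3 : ∀ s a → s N.+ suc a ≡ suc s N.+ a
        l3 = NS.solve-∀
        l4 : ∀ a s' → 3 N.* a N.+ 3 N.+ s' ≡ a N.+ a N.+ 2 N.+ s' N.+ suc a
        l4 = NS.solve-∀
      sx : s ≡ a N.+ a N.+ 2 N.+ s'
      sx = l2 s a s' (trans (sym xa) ex)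

    B-pos : e ≢ 1 → s' ≢ 1 → (∀ w → s ≡ 4 N.* w N.+ 2 → (s' ≢ 0) × (s' ≢ 4)) → (∀ w → s ≡ 4 N.* w N.+ 4 → s' ≢ 2) → + 1 Z.≤ B e
    B-pos e≢1 s'≢1 mod4≡1-cases mod4≡3-case with suc s N.≤? e
    ... | no q = subst (+ 1 Z.≤_) (sym (trans (cong (λ z → + parts23 e - z) (shift-< (suc s) (natSeries parts12) e (NP.≰⇒> q))) (ZP.+-identityʳ _))) (Z.+≤+ (parts23-pos e e≢1))
    ... | yes q with epos q | parity (e ∸ suc s)
    ...   | ex , sx | w , inj₁ aw = subst (+ 1 Z.≤_) (sym (Bform e q)) (one≤sub-ℕ (subst (λ z → suc (parts12 z) N.≤ parts23 e) (sym aw)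
              (subst (λ z → suc (parts12 (w N.+ w)) N.≤ parts23 z) (sym (trans ex (cong (λ z → offset z s') aw))) (parts12<parts23-even w s' s'≢0 s'≢1 s'≢2 s'≢4))))
      where
      sw : s ≡ w N.+ w N.+ (w N.+ w) N.+ 2 N.+ s'
      sw = trans sx (cong (λ z → z N.+ z N.+ 2 N.+ s') aw)
      l0 : ∀ w → w N.+ w N.+ (w N.+ w) N.+ 2 N.+ 0 ≡ 4 N.* w N.+ 2
      l0 = NS.solve-∀
      l2 : ∀ w → w N.+ w N.+ (w N.+ w) N.+ 2 N.+ 2 ≡ 4 N.* w N.+ 4
      l2 = NS.solve-∀
      l4 : ∀ w → w N.+ w N.+ (w N.+ w) N.+ 2 N.+ 4 ≡ 4 N.* suc w N.+ 2
      l4 = NS.solve-∀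
      s'≢0 : s' ≢ 0
      s'≢0 z = proj₁ (mod4≡1-cases w (trans sw (trans (cong (λ t → w N.+ w N.+ (w N.+ w) N.+ 2 N.+ t) z) (l0 w)))) z
      s'≢2 : s' ≢ 2
      s'≢2 z = mod4≡3-case w (trans sw (trans (cong (λ t → w N.+ w N.+ (w N.+ w) N.+ 2 N.+ t) z) (l2 w))) z
      s'≢4 : s' ≢ 4
      s'≢4 z = proj₂ (mod4≡1-cases (suc w) (trans sw (trans (cong (λ t → w N.+ w N.+ (w N.+ w) N.+ 2 N.+ t) z) (l4 w)))) z
    ...   | ex , sx | w , inj₂ aw = subst (+ 1 Z.≤_) (sym (Bform e q)) (one≤sub-ℕ (subst (λ z → suc (parts12 z) N.≤ parts23 e) (sym aw)
              (subst (λ z → suc (parts12 (suc (w N.+ w))) N.≤ parts23 z) (sym (trans ex (cong (λ z → offset z s') aw))) (parts12<parts23-odd w s' s'≢1))))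

    constant-term : + 0 Z.≤ g 0
    constant-term = constant-term-nonneg e (gauss 3 s) (gauss 1 s') (gauss-at-zero 3 s) (gauss-at-zero 1 s')

    l3s : ∀ s → s N.+ s N.+ s ≡ 3 N.* s
    l3s = NS.solve-∀

    nonneg-unimodal : e ≢ 1 → s' ≢ 1 → (∀ w → s ≡ 4 N.* w N.+ 2 → (s' ≢ 0) × (s' ≢ 4)) → (∀ w → s ≡ 4 N.* w N.+ 4 → s' ≢ 2) →
            Nonnegative g × Unimodal g
    nonneg-unimodal e≢1 s'≢1 mod4≡1-cases mod4≡3-case with parity (s N.+ s N.+ s)
    ... | C , par = palindromic-unimodal g C (3 N.* s) D≤2C+1 palindromic-g constant-term (λ n p → rising-step g n (Δ≥0 (suc n) (NP.≤-trans (NP.+-mono-≤ p p) CC)))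
      where
      CC : C N.+ C N.≤ s N.+ s N.+ s
      CC = [ (λ q → NP.≤-reflexive (sym q)) , (λ q → NP.≤-trans (NP.n≤1+n _) (NP.≤-reflexive (sym q))) ]′ par
      D≤2C+1 : 3 N.* s N.≤ suc (C N.+ C)
      D≤2C+1 = [ (λ q → NP.≤-trans (NP.≤-reflexive (trans (sym (l3s s)) q)) (NP.n≤1+n _)) , (λ q → NP.≤-reflexive (trans (sym (l3s s)) q)) ]′ par
      Δ≥0 : ∀ x → x N.+ x N.≤ s N.+ s N.+ s → + 0 Z.≤ Δ g x
      Δ≥0 x p with x N.≟ e
      ... | yes refl = subst (+ 0 Z.≤_) (sym (Δg x p)) (sub-nonneg-of-bounds (B-pos e≢1 s'≢1 mod4≡1-cases mod4≡3-case) (ZP.≤-reflexive sh1-eq))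
      ... | no q = subst (+ 0 Z.≤_) (sym (trans (Δg x p) (trans (cong (λ z → B x - z) (sh1-neq x q)) (ZP.+-identityʳ _)))) (B-nonneg x p)

    not-unimodal-if-vanishing : ∀ e' → e ≡ suc e' → B e ≡ + 0 → ¬ Unimodal g
    not-unimodal-if-vanishing e' ee Be = palindromic-not-unimodal g (3 N.* s) e' palindromic-g le (falling-step g e' Δ<0)
      where
      le : suc (e' N.+ e') N.≤ 3 N.* s
      le = subst (suc (e' N.+ e') N.≤_) (l3s s) (NP.≤-trans (s≤s (NP.+-monoʳ-≤ e' (NP.n≤1+n e'))) (subst (λ z → z N.+ z N.≤ s N.+ s N.+ s) ee ee3))
      Δ<0 : Δ g (suc e') Z.< + 0
      Δ<0 = subst (Z._< + 0) (sym (trans (cong (Δ g) (sym ee)) (trans (Δg e ee3) (cong₂ _-_ Be sh1-eq)))) Z.-<+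

    -- e = 1 (that is, b + 10 = 3m) gives B(1) = p_{23}(1) = 0.
    not-unimodal-if-e≡1 : e ≡ 1 → ¬ Unimodal g
    not-unimodal-if-e≡1 e1 with s N.≟ 0
    ... | yes s0 = λ _ → NP.1+n≢0 (trans (cong (λ z → z N.+ z N.+ s') (sym e1)) (trans h (cong (λ z → z N.+ z N.+ z) s0)))
    ... | no s0 = not-unimodal-if-vanishing 0 e1 (trans (cong (λ z → + parts23 z - shiftBy (suc s) (natSeries parts12) z) e1)
      (cong (λ z → + 0 - z) (shift-< (suc s) (natSeries parts12) 1 (s≤s (NP.n≢0⇒n>0 s0)))))

    not-unimodal-at-offset : ∀ a δ → e ≡ offset a δ → e ≡ suc s N.+ a → parts23 (offset a δ) ≡ parts12 a → ¬ Unimodal g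
    not-unimodal-at-offset a δ ei es zz = not-unimodal-if-vanishing (3 N.* a N.+ 2 N.+ δ) (trans ei (l a δ))
       (trans (Bform e (subst (suc s N.≤_) (sym es) (NP.m≤m+n (suc s) a)))
       (trans (cong₂ (λ x y → + parts23 x - + parts12 y) ei (∸-of-+ (suc s) es)) (trans (cong (λ z → + z - + parts12 a) zz) (ZP.+-inverseʳ (+ parts12 a)))))
      where
      l : ∀ a δ → 3 N.* a N.+ 3 N.+ δ ≡ suc (3 N.* a N.+ 2 N.+ δ)
      l = NS.solve-∀

  ConditionsThree : ℕ → ℕ → Set
  ConditionsThree m b = (b N.+ 10 ≢ 3 N.* m) × (2 ∣ m → b ≢ 2) × (m % 4 ≡ 1 → (b ≢ 1) × (b ≢ 5)) × (m % 4 ≡ 3 → b ≢ 3)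

  -- Translating Admissible 3 m b: with v = (s + s')/2 (an integer by the parity
  -- hypothesis) the exponent of f(3, 3+s, 1+s') is e = 2s - v, so f is
  -- CaseThree.g; the conditions on (m, b) become conditions on (e, s, s').
  module ReductionThree (s s' : ℕ) (bnd : 1 N.* (1 N.+ s') N.≤ 3 N.* (3 N.+ s) N.+ 4 ∸ 12) (par : 2 ∣ 3 N.* (3 N.+ s) N.+ 3 N.* (1 N.+ s')) where
    s'≤ : s' N.≤ s N.+ s N.+ s
    s'≤ = NP.≤-pred (subst₂ N._≤_ (l1 s') (∸-of-+ 12 (l2 s)) bnd)
      where
      l1 : ∀ s' → 1 N.* (1 N.+ s') ≡ suc s'
      l1 = NS.solve-∀
      l2 : ∀ s → 3 N.* (3 N.+ s) N.+ 4 ≡ 12 N.+ suc (s N.+ s N.+ s)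
      l2 = NS.solve-∀

    vv : Σ ℕ (λ v → s N.+ s' ≡ v N.+ v)
    vv with parity (s N.+ s')
    ... | v , inj₁ p = v , p
    ... | v , inj₂ p = ⊥-elim (2∤odd (7 N.+ 3 N.* v) (subst (2 ∣_) (trans (l s s') (trans (cong (λ z → 12 N.+ 3 N.* z) p) (l' v))) par))
      where
      l : ∀ s s' → 3 N.* (3 N.+ s) N.+ 3 N.* (1 N.+ s') ≡ 12 N.+ 3 N.* (s N.+ s')
      l = NS.solve-∀
      l' : ∀ v → 12 N.+ 3 N.* suc (v N.+ v) ≡ suc ((7 N.+ 3 N.* v) N.+ (7 N.+ 3 N.* v))
      l' = NS.solve-∀
    v : ℕ
    v = proj₁ vv
    sv : s N.+ s' ≡ v N.+ v
    sv = proj₂ vv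
    v≤ : v N.≤ s N.+ s
    v≤ = double-cancel-≤ v (s N.+ s) (subst₂ N._≤_ sv (l s) (NP.+-monoʳ-≤ s s'≤))
      where
      l : ∀ s → s N.+ (s N.+ s N.+ s) ≡ (s N.+ s) N.+ (s N.+ s)
      l = NS.solve-∀
    e : ℕ
    e = (s N.+ s) ∸ v
    ev' : e N.+ v ≡ s N.+ s
    ev' = NP.m∸n+n≡m v≤
    h : e N.+ e N.+ s' ≡ s N.+ s N.+ s
    h = NP.+-cancelʳ-≡ s _ _ (trans (l1 e s' s) (trans (cong (λ z → e N.+ e N.+ z) sv) (trans (l2 e v) (trans (cong (λ z → z N.+ z) ev') (l3 s)))))
      where
      l1 : ∀ e s' s → e N.+ e N.+ s' N.+ s ≡ e N.+ e N.+ (s N.+ s')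
      l1 = NS.solve-∀
      l2 : ∀ e v → e N.+ e N.+ (v N.+ v) ≡ (e N.+ v) N.+ (e N.+ v)
      l2 = NS.solve-∀
      l3 : ∀ s → (s N.+ s) N.+ (s N.+ s) ≡ s N.+ s N.+ s N.+ s
      l3 = NS.solve-∀
    ex : expo 3 (3 N.+ s) (1 N.+ s') ≡ e
    ex = trans (cong (λ z → z N./ 2 ∸ 4) (∸-of-+ (1 N.* (1 N.+ s')) eq)) (trans (cong (_∸ 4) (double/2 (4 N.+ e))) (NP.m+n∸m≡n 4 e))
      where
      l1 : ∀ s' e → 1 N.* (1 N.+ s') N.+ ((4 N.+ e) N.+ (4 N.+ e)) ≡ 9 N.+ (e N.+ e N.+ s')
      l1 = NS.solve-∀
      l2 : ∀ s → 9 N.+ (s N.+ s N.+ s) ≡ 3 N.* (3 N.+ s)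
      l2 = NS.solve-∀
      eq : 3 N.* (3 N.+ s) ≡ 1 N.* (1 N.+ s') N.+ ((4 N.+ e) N.+ (4 N.+ e))
      eq = sym (trans (l1 s' e) (trans (cong (9 N.+_) h) (l2 s)))
    fg : f 3 (3 N.+ s) (1 N.+ s') ≗ CaseThree.g s s' e h
    fg n = cong (λ z → gauss 3 s n - shiftBy z (gauss 1 s') n) ex

    b+10≡3m⇒e≡1 : suc s' N.+ 10 ≡ 3 N.* (3 N.+ s) → e ≡ 1
    b+10≡3m⇒e≡1 p = double-injective e 1 (NP.+-cancelʳ-≡ s' _ _ (trans h (NP.+-cancelˡ-≡ 9 _ _ (trans (l2 s) (trans (sym p) (l1 s'))))))
      where
      l1 : ∀ s' → suc s' N.+ 10 ≡ 9 N.+ (1 N.+ 1 N.+ s')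
      l1 = NS.solve-∀
      l2 : ∀ s → 9 N.+ (s N.+ s N.+ s) ≡ 3 N.* (3 N.+ s)
      l2 = NS.solve-∀
    e≡1⇒b+10≡3m : e ≡ 1 → suc s' N.+ 10 ≡ 3 N.* (3 N.+ s)
    e≡1⇒b+10≡3m p = trans (l1 s') (trans (cong (λ z → 9 N.+ (z N.+ z N.+ s')) (sym p)) (trans (cong (9 N.+_) h) (l2 s)))
      where
      l1 : ∀ s' → suc s' N.+ 10 ≡ 9 N.+ (1 N.+ 1 N.+ s')
      l1 = NS.solve-∀
      l2 : ∀ s → 9 N.+ (s N.+ s N.+ s) ≡ 3 N.* (3 N.+ s)
      l2 = NS.solve-∀

    G : Set
    G = Nonnegative (CaseThree.g s s' e h) × Unimodal (CaseThree.g s s' e h)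

    sufficient : ConditionsThree (3 N.+ s) (1 N.+ s') → G
    sufficient (b+10≢3m , m-even⇒b≢2 , m≡1⇒b≢1,5 , m≡3⇒b≢3) = CaseThree.nonneg-unimodal s s' e h e≢1 s'≢1 mod4≡1-cases mod4≡3-case
      where
      e≢1 : e ≢ 1
      e≢1 e≡1 = b+10≢3m (e≡1⇒b+10≡3m e≡1)
      -- s' = 1 means s odd, i.e. m = 3 + s even.
      s'≢1 : s' ≢ 1
      s'≢1 s'≡1 = m-even⇒b≢2 (subst (2 ∣_) (m≡2v+2 s v (trans (cong (s N.+_) (sym s'≡1)) sv)) (2∣double (suc v))) (cong suc s'≡1)
        where
        m≡2v+2 : ∀ s v → s N.+ 1 ≡ v N.+ v → suc v N.+ suc v ≡ 3 N.+ s
        m≡2v+2 s v q = trans (cong suc (NP.+-suc v v)) (cong (λ z → suc (suc z)) (trans (sym q) (NP.+-comm s 1)))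
      mod4≡1-cases : ∀ w → s ≡ 4 N.* w N.+ 2 → (s' ≢ 0) × (s' ≢ 4)
      mod4≡1-cases w s≡4w+2 = (λ s'≡0 → proj₁ b≢1,5 (cong suc s'≡0)) , (λ s'≡4 → proj₂ b≢1,5 (cong suc s'≡4))
        where
        b≢1,5 : (suc s' ≢ 1) × (suc s' ≢ 5)
        b≢1,5 = m≡1⇒b≢1,5 (subst (λ z → (3 N.+ z) % 4 ≡ 1) (sym s≡4w+2) (mod4≡1-intro w))
      mod4≡3-case : ∀ w → s ≡ 4 N.* w N.+ 4 → s' ≢ 2
      mod4≡3-case w s≡4w+4 s'≡2 = m≡3⇒b≢3 (subst (λ z → (3 N.+ z) % 4 ≡ 3) (sym s≡4w+4) (mod4≡3-intro w)) (cong suc s'≡2)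

    U : Set
    U = Unimodal (CaseThree.g s s' e h)

    -- Each excluded pair (m, b) forces B(e) = 0: b + 10 = 3m (that is, e = 1),
    -- b = 2 with m even, b ∈ {1, 5} with m ≡ 1 and b = 3 with m ≡ 3 (mod 4).
    fails-b+10≡3m : e ≡ 1 → ¬ U
    fails-b+10≡3m = CaseThree.not-unimodal-if-e≡1 s s' e h

    fails-b≡2 : s' ≡ 1 → ¬ U
    fails-b≡2 p with parity s
    ... | u , inj₁ su = ⊥-elim (odd≢even e (u N.+ u N.+ u) (trans (l1 e) (trans (cong (λ z → e N.+ e N.+ z) (sym p)) (trans h (trans (cong (λ z → z N.+ z N.+ z) su) (l2 u))))))
      where
      l1 : ∀ e → suc (e N.+ e) ≡ e N.+ e N.+ 1
      l1 = NS.solve-∀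
      l2 : ∀ u → (u N.+ u) N.+ (u N.+ u) N.+ (u N.+ u) ≡ (u N.+ u N.+ u) N.+ (u N.+ u N.+ u)
      l2 = NS.solve-∀
    ... | u , inj₂ su = go u su (double-injective e (3 N.* u N.+ 1)
      (NP.+-cancelʳ-≡ 1 _ _ (trans (cong (λ z → e N.+ e N.+ z) (sym p)) (trans h (trans (cong (λ z → z N.+ z N.+ z) su) (l2 u))))))
      where
      l2 : ∀ u → suc (u N.+ u) N.+ suc (u N.+ u) N.+ suc (u N.+ u) ≡ (3 N.* u N.+ 1) N.+ (3 N.* u N.+ 1) N.+ 1
      l2 = NS.solve-∀
      go : ∀ u → s ≡ suc (u N.+ u) → e ≡ 3 N.* u N.+ 1 → ¬ U
      go zero su eu = fails-b+10≡3m eu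
      go (suc u') su eu = CaseThree.not-unimodal-at-offset s s' e h u' 1 (trans eu (l3 u')) (trans eu (trans (l4 u') (cong (λ z → suc z N.+ u') (sym su)))) (parts23-offset1 u')
        where
        l3 : ∀ u' → 3 N.* suc u' N.+ 1 ≡ 3 N.* u' N.+ 3 N.+ 1
        l3 = NS.solve-∀
        l4 : ∀ u' → 3 N.* suc u' N.+ 1 ≡ suc (suc (suc u' N.+ suc u')) N.+ u'
        l4 = NS.solve-∀

    fails-b≡1 : ∀ w → s ≡ 4 N.* w N.+ 2 → s' ≡ 0 → ¬ U
    fails-b≡1 w sw p = CaseThree.not-unimodal-at-offset s s' e h (w N.+ w) 0 (trans ee (l2 w)) (trans ee (trans (l3 w) (cong (λ z → suc z N.+ (w N.+ w)) (sym sw)))) (parts23-offset-even 0 refl w)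
      where
      l1 : ∀ w → (4 N.* w N.+ 2) N.+ (4 N.* w N.+ 2) N.+ (4 N.* w N.+ 2) ≡ (6 N.* w N.+ 3) N.+ (6 N.* w N.+ 3)
      l1 = NS.solve-∀
      ee : e ≡ 6 N.* w N.+ 3
      ee = double-injective e _ (trans (sym (NP.+-identityʳ (e N.+ e))) (trans (cong (λ z → e N.+ e N.+ z) (sym p)) (trans h (trans (cong (λ z → z N.+ z N.+ z) sw) (l1 w)))))
      l2 : ∀ w → 6 N.* w N.+ 3 ≡ 3 N.* (w N.+ w) N.+ 3 N.+ 0
      l2 = NS.solve-∀
      l3 : ∀ w → 6 N.* w N.+ 3 ≡ suc (4 N.* w N.+ 2) N.+ (w N.+ w)
      l3 = NS.solve-∀

    fails-b≡5 : ∀ w → s ≡ 4 N.* w N.+ 2 → s' ≡ 4 → ¬ U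
    fails-b≡5 w sw p = go w sw ee
      where
      l1 : ∀ w → (4 N.* w N.+ 2) N.+ (4 N.* w N.+ 2) N.+ (4 N.* w N.+ 2) ≡ (6 N.* w N.+ 1) N.+ (6 N.* w N.+ 1) N.+ 4
      l1 = NS.solve-∀
      ee : e ≡ 6 N.* w N.+ 1
      ee = double-injective e _ (NP.+-cancelʳ-≡ 4 _ _ (trans (cong (λ z → e N.+ e N.+ z) (sym p)) (trans h (trans (cong (λ z → z N.+ z N.+ z) sw) (l1 w)))))
      go : ∀ w → s ≡ 4 N.* w N.+ 2 → e ≡ 6 N.* w N.+ 1 → ¬ U
      go zero sw ee = fails-b+10≡3m ee
      go (suc w') sw ee = CaseThree.not-unimodal-at-offset s s' e h (w' N.+ w') 4 (trans ee (l2 w'))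
        (trans ee (trans (l3 w') (cong (λ z → suc z N.+ (w' N.+ w')) (sym sw)))) (parts23-offset-even 4 refl w')
        where
        l2 : ∀ w' → 6 N.* suc w' N.+ 1 ≡ 3 N.* (w' N.+ w') N.+ 3 N.+ 4
        l2 = NS.solve-∀
        l3 : ∀ w' → 6 N.* suc w' N.+ 1 ≡ suc (4 N.* suc w' N.+ 2) N.+ (w' N.+ w')
        l3 = NS.solve-∀

    fails-b≡3 : ∀ w → s ≡ 4 N.* w → s' ≡ 2 → ¬ U
    fails-b≡3 zero sw p = λ _ → NP.<⇒≱ (subst (0 N.<_) (sym p) (s≤s z≤n)) (subst (λ z → s' N.≤ z N.+ z N.+ z) sw s'≤)
    fails-b≡3 (suc w') sw p = CaseThree.not-unimodal-at-offset s s' e h (w' N.+ w') 2 (trans ee (l2 w'))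
      (trans ee (trans (l3 w') (cong (λ z → suc z N.+ (w' N.+ w')) (sym sw)))) (parts23-offset-even 2 refl w')
      where
      l1 : ∀ w' → 4 N.* suc w' N.+ 4 N.* suc w' N.+ 4 N.* suc w' ≡ (6 N.* w' N.+ 5) N.+ (6 N.* w' N.+ 5) N.+ 2
      l1 = NS.solve-∀
      ee : e ≡ 6 N.* w' N.+ 5
      ee = double-injective e _ (NP.+-cancelʳ-≡ 2 _ _ (trans (cong (λ z → e N.+ e N.+ z) (sym p)) (trans h (trans (cong (λ z → z N.+ z N.+ z) sw) (l1 w')))))
      l2 : ∀ w' → 6 N.* w' N.+ 5 ≡ 3 N.* (w' N.+ w') N.+ 3 N.+ 2
      l2 = NS.solve-∀
      l3 : ∀ w' → 6 N.* w' N.+ 5 ≡ suc (4 N.* suc w') N.+ (w' N.+ w')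
      l3 = NS.solve-∀

    necessary : U → ConditionsThree (3 N.+ s) (1 N.+ s')
    necessary u = (λ p → fails-b+10≡3m (b+10≡3m⇒e≡1 p) u) , (λ _ b2 → fails-b≡2 (NP.suc-injective b2) u) ,
           (λ m1 → (λ b1 → fails-b≡1 (proj₁ (mod4≡1 s m1)) (proj₂ (mod4≡1 s m1)) (NP.suc-injective b1) u) ,
                   (λ b5 → fails-b≡5 (proj₁ (mod4≡1 s m1)) (proj₂ (mod4≡1 s m1)) (NP.suc-injective b5) u)) ,
           (λ m3 b3 → fails-b≡3 (proj₁ (mod4≡3 s m3)) (proj₂ (mod4≡3 s m3)) (NP.suc-injective b3) u)

    equivalence : (Nonnegative (f 3 (3 N.+ s) (1 N.+ s')) × Unimodal (f 3 (3 N.+ s) (1 N.+ s'))) ⇔ ConditionsThree (3 N.+ s) (1 N.+ s')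
    equivalence = mk⇔ (λ nu → necessary (unimodal-≗ fg (proj₂ nu))) (λ c → nonneg-unimodal-≗ (≗-sym fg) (sufficient c))

  theorem-k3 : (m b : ℕ) → Admissible 3 m b → ((Nonnegative (f 3 m b) × Unimodal (f 3 m b)) ⇔ ConditionsThree m b)
  theorem-k3 0 b (_ , () , _)
  theorem-k3 1 b (_ , s≤s () , _)
  theorem-k3 2 b (_ , s≤s (s≤s ()) , _)
  theorem-k3 (suc (suc (suc s))) 0 (_ , _ , () , _)
  theorem-k3 (suc (suc (suc s))) (suc s') (_ , _ , _ , bnd , par) =
    ReductionThree.equivalence s s' (bnd (s≤s (s≤s (s≤s z≤n)))) par

open Development using (theorem-k2; theorem-k3; theorem-k4)

open import Data.Nat using (ℕ; _+_; _*_; _%_)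
open import Data.Nat.Divisibility using (_∣_)
open import Data.Product using (_×_; _,_)
open import Relation.Binary.PropositionalEquality using (_≡_; _≢_)
open import Function.Bundles using (_⇔_)

theorem2p2 : ((m b : ℕ) → Admissible 2 m b →
    ((Nonnegative (f 2 m b) × Unimodal (f 2 m b)) ⇔ (2 ∣ m)))
    × ((m b : ℕ) → Admissible 3 m b →
    ((Nonnegative (f 3 m b) × Unimodal (f 3 m b)) ⇔
    ((b + 10 ≢ 3 * m)
    × (2 ∣ m → b ≢ 2)
    × (m % 4 ≡ 1 → (b ≢ 1) × (b ≢ 5))
    × (m % 4 ≡ 3 → b ≢ 3))))
    × ((m b : ℕ) → Admissible 4 m b →
    ((Nonnegative (f 4 m b) × Unimodal (f 4 m b)) ⇔ ((2 ∣ b) × (m ≢ 5))))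
theorem2p2 = theorem-k2 , theorem-k3 , theorem-k4
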